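{- Let $n\ge 1$. The map $\rho\circ\gamma: S_1\times S_{n-1}\to\mathrm{plane}(n)$ is such that its fibers form a lattice congruence of the weak order on $S_1\times S_{n-1}$; consequently there is a lattice structure on $\mathrm{plane}(n)$ making $\rho\circ\gamma$ a lattice quotient (a surjective, order-preserving map preserving joins and meets) of the weak order, and this lattice on $\mathrm{plane}(n)$ is isomorphic to the Tamari lattice (with $C_{n-1}$ elements, $C_m$ the $m$-th Catalan number).
   Context: $S_1\times S_{n-1}$ denotes the set of permutations $\alpha$ of $\{1,\dots,n\}$ with $\alpha(1)=1$, in one-line notation. An inversion of $\alpha$ is a pair of positions $(i,j)$ with $i<j$ and $\alpha(i)>\alpha(j)$; $\mathrm{Inv}(\alpha)$ is the set of inversions. The weak order on $S_1\times S_{n-1}$ is $\alpha\le\beta$ iff $\mathrm{Inv}(\alpha)\subseteq\mathrm{Inv}(\beta)$; it is a lattice. The first inversion from position $i$ (if any) is the inversion $(i,j)$ with $j$ minimal. The first inversion tree $\gamma(\alpha)$ is the rooted tree on vertices labelled $1,\dots,n$ with root $1$ in which for each label $i\neq1$ the parent of $i$ is $j$ if $(\alpha^{ -1}(i),\alpha^{ -1}(j))$ is the first inversion from position $\alpha^{ -1}(i)$, and is $1$ if there is no inversion from that position; it is an increasing tree. A plane tree is a rooted tree with the children of each vertex linearly ordered; $\mathrm{plane}(n)$ is the set of plane trees on $n$ vertices. For an increasing tree $T$, $\rho(T)$ is the plane tree obtained by ordering the children of each vertex by increasing label. A lattice congruence is an equivalence relation whose classes are the fibers of a lattice quotient. 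-}

module Defs where

open import Data.Nat using (ℕ; zero; suc; _+_)
open import Data.Fin using (Fin; zero; suc; _<_)
open import Data.Fin.Properties using (_≟_; _<?_)
open import Data.List using (List; []; _∷_; filter; map; head; allFin)
open import Data.Unit using (⊤)
open import Data.Maybe using (Maybe; just; nothing)
open import Data.Product using (Σ; ∃; _×_; _,_; proj₁)
open import Relation.Nullary using (¬_)
open import Relation.Nullary.Decidable using (_×-dec_; ¬?)
open import Relation.Binary.PropositionalEquality using (_≡_)
open import Relation.Binary.Construct.Closure.ReflexiveTransitive using (Star)
open import Function.Bundles using (_↔_; Inverse)

module _ {A : Set} (_≤_ : A → A → Set) where

  IsJoin : A → A → A → Set
  IsJoin x y z = x ≤ z × y ≤ z × (∀ w → x ≤ w → y ≤ w → z ≤ w)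

  IsMeet : A → A → A → Set
  IsMeet x y z = z ≤ x × z ≤ y × (∀ w → w ≤ x → w ≤ y → w ≤ z)

  HasAllJoins : Set
  HasAllJoins = ∀ x y → ∃ λ z → IsJoin x y z

  HasAllMeets : Set
  HasAllMeets = ∀ x y → ∃ λ z → IsMeet x y z

  CompatibleWithJoinsMeets : (A → A → Set) → Set
  CompatibleWithJoinsMeets E =
    (∀ x y z j j' → E x y → IsJoin x z j → IsJoin y z j' → E j j') ×
    (∀ x y z j j' → E x y → IsMeet x z j → IsMeet y z j' → E j j')

-- Permutations of {1..n} fixing 1 (positions/values 1..n are Fin n,
-- with label 1 represented by Fin.zero).  One-line notation: α(i) = to α i.

Perm : ℕ → Set
Perm n = Fin n ↔ Fin n

-- S₁ × S_{n-1}
-- α(1) = 1  (for n = 0 there is no position 1 and the condition is empty)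
FixesFirst : ∀ {n} → Perm n → Set
FixesFirst {zero}  α = ⊤
FixesFirst {suc n} α = Inverse.to α zero ≡ zero

S1×S : ℕ → Set
S1×S n = Σ (Perm n) FixesFirst

IsInversion : ∀ {n} → Perm n → Fin n → Fin n → Set
IsInversion α i j = i < j × Inverse.to α j < Inverse.to α i

_≤weak_ : ∀ {n} → S1×S n → S1×S n → Set
_≤weak_ {n} (α , _) (β , _) = ∀ (i j : Fin n) → IsInversion α i j → IsInversion β i j

firstInversion : ∀ {n} → Perm n → Fin n → Maybe (Fin n)
firstInversion {n} α p =
  head (filter (λ q → (p <? q) ×-dec (Inverse.to α q <? Inverse.to α p)) (allFin n))

-- parent label of label i in γ(α) (meaningful for i ≠ 1; root 1 = zero)
γparent : ∀ {n} → Perm n → Fin n → Fin n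
γparent {suc n} α i with firstInversion α (Inverse.from α i)
... | just q  = Inverse.to α q
... | nothing = zero

data PTree : Set where
  node : List PTree → PTree

mutual
  size : PTree → ℕ
  size (node ts) = suc (sizes ts)

  sizes : List PTree → ℕ
  sizes []       = 0
  sizes (t ∷ ts) = size t + sizes ts

Plane : ℕ → Set
Plane n = Σ PTree (λ t → size t ≡ n)

childrenOf : ∀ {n} → (Fin (suc n) → Fin (suc n)) → Fin (suc n) → List (Fin (suc n))
childrenOf {n} par v = filter (λ i → ¬? (i ≟ zero) ×-dec (par i ≟ v)) (allFin (suc n))

-- ρ: plane subtree rooted at v, children ordered by increasing label.
-- Defined with fuel k (depth bound); for an increasing tree on n labels
-- fuel n suffices to build the whole tree.
ρsub : ∀ {n} → (Fin (suc n) → Fin (suc n)) → ℕ → Fin (suc n) → PTree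
ρsub par zero    v = node []
ρsub par (suc k) v = node (map (ρsub par k) (childrenOf par v))

ρ : ∀ {n} → (Fin n → Fin n) → PTree
ρ {zero}  par = node []
ρ {suc n} par = ρsub par (suc n) zero

ργ : ∀ {n} → S1×S n → PTree
ργ (α , _) = ρ (γparent α)

data BTree : Set where
  leaf : BTree
  bin  : BTree → BTree → BTree

nodes : BTree → ℕ
nodes leaf      = 0
nodes (bin l r) = suc (nodes l + nodes r)

data Rot : BTree → BTree → Set where
  rot   : ∀ A B C → Rot (bin (bin A B) C) (bin A (bin B C))
  left  : ∀ {A A'} B → Rot A A' → Rot (bin A B) (bin A' B)
  right : ∀ A {B B'} → Rot B B' → Rot (bin A B) (bin A B')

Tamari : ℕ → Set
Tamari m = Σ BTree (λ t → nodes t ≡ m)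

_≤Tam_ : ∀ {m} → Tamari m → Tamari m → Set
(s , _) ≤Tam (t , _) = Star Rot s t

{-# OPTIONS --safe #-}
-- Read in positions, γ(α) is the tree in which the parent of position p is the position
-- E(p) of the first inversion from p (the root if there is none); relabelling positions by
-- their values keeps siblings in order, so ρ(γ(α)) only depends on E. The arcs p ↦ E(p)
-- never cross, and non-crossing arc systems on 1 … n-1 are exactly the bracket vectors of
-- binary trees with n-1 nodes: under the first-child/next-sibling bijection between plane(n)
-- and binary trees, ρ(γ(α)) is the binary tree with bracket vector E, and the Tamari order is
-- the reverse componentwise order of bracket vectors. The weak order reverses E, and for every
-- bracket vector u there is a greatest permutation with E ≥ u (inversions: u(p) ≤ q) and a
-- least one with E ≤ u. So ρ∘γ has an upper and a lower adjoint: it is surjective, preserves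
-- joins and meets, and its fibres form a lattice congruence.

module Submission where

open import Defs
open import Level using (Level; 0ℓ)
open import Data.Empty using (⊥-elim)
open import Data.Nat
  using (ℕ; zero; suc; _+_; _≤_; _<_; _≤?_; _<?_; _⊓_; _⊔_; z≤n; s≤s; z<s)
open import Data.Nat.Properties
open import Data.Nat.Tactic.RingSolver using (solve-∀)
open import Data.Fin as Fin using (Fin; toℕ; fromℕ<; punchOut)
import Data.Fin.Properties as Finₚ
open import Data.Maybe using (just; nothing)
open import Data.Product using (Σ; ∃; _×_; _,_; proj₁; proj₂)
open import Data.Sum using (_⊎_; inj₁; inj₂; [_,_]′)
open import Data.List using (List; []; _∷_; map; filter; allFin; length; head)
open import Data.List.Properties using (map-cong; map-∘; length-tabulate)
open import Data.List.Membership.Propositional using (_∈_)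
open import Data.List.Membership.Propositional.Properties
  using (∈-filter⁺; ∈-filter⁻; ∈-allFin; ∈-map⁺; ∈-map⁻)
open import Data.List.Relation.Binary.Subset.Propositional using (_⊆_)
open import Data.List.Relation.Unary.All as All using (All; []; _∷_)
import Data.List.Relation.Unary.All.Properties as Allₚ
open import Data.List.Relation.Unary.AllPairs as AllPairs using (AllPairs; []; _∷_)
import Data.List.Relation.Unary.AllPairs.Properties as AllPairsₚ
open import Data.List.Relation.Unary.Any using (here; there)
open import Function using (_∘_; id)
open import Function.Bundles using (_↔_; _⇔_; Inverse; mk↔ₛ′; mk⇔)
open import Function.Definitions using (Injective)
open import Relation.Nullary using (¬_; Dec; yes; no; contradiction)
open import Relation.Nullary.Decidable using (_×-dec_; _⊎-dec_; _→-dec_; ¬?)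
open import Relation.Unary using (Pred)
import Relation.Unary as U
open import Relation.Unary.Properties using (U?)
open import Relation.Binary using (Rel)
open import Relation.Binary.Definitions using (tri<; tri≈; tri>)
open import Relation.Binary.PropositionalEquality
open import Relation.Binary.Structures using (IsPartialOrder)
open import Relation.Binary.Construct.Closure.ReflexiveTransitive using (Star; ε; _◅_; _◅◅_; gmap)

module _ {A B : Set} {_≤A_ : A → A → Set} {_≤B_ : B → B → Set}
         (f : A → B) (f-mono : ∀ {x y} → x ≤A y → f x ≤B f y) where

  upperAdjoint⇒preservesJoins : (g : B → A) → (∀ {a b} → f a ≤B b → a ≤A g b) → (∀ {a b} → a ≤A g b → f a ≤B b) →
                                ∀ x y j → IsJoin _≤A_ x y j → IsJoin _≤B_ (f x) (f y) (f j)
  upperAdjoint⇒preservesJoins g f⊣g f⊣g⁻¹ x y j (x≤j , y≤j , least) =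
    f-mono x≤j , f-mono y≤j , λ w fx≤w fy≤w → f⊣g⁻¹ (least (g w) (f⊣g fx≤w) (f⊣g fy≤w))

  lowerAdjoint⇒preservesMeets : (h : B → A) → (∀ {a b} → b ≤B f a → h b ≤A a) → (∀ {a b} → h b ≤A a → b ≤B f a) →
                                ∀ x y j → IsMeet _≤A_ x y j → IsMeet _≤B_ (f x) (f y) (f j)
  lowerAdjoint⇒preservesMeets h h⊣f h⊣f⁻¹ x y j (j≤x , j≤y , greatest) =
    f-mono j≤x , f-mono j≤y , λ w w≤fx w≤fy → h⊣f⁻¹ (greatest (h w) (h⊣f w≤fx) (h⊣f w≤fy))

module _ {A : Set} {_≤_ : A → A → Set} (antisym : ∀ {x y} → x ≤ y → y ≤ x → x ≡ y) where

  join-unique : ∀ {x y j j′} → IsJoin _≤_ x y j → IsJoin _≤_ x y j′ → j ≡ j′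
  join-unique (x≤j , y≤j , least) (x≤j′ , y≤j′ , least′) = antisym (least _ x≤j′ y≤j′) (least′ _ x≤j y≤j)

  meet-unique : ∀ {x y j j′} → IsMeet _≤_ x y j → IsMeet _≤_ x y j′ → j ≡ j′
  meet-unique (j≤x , j≤y , greatest) (j′≤x , j′≤y , greatest′) = antisym (greatest′ _ j≤x j≤y) (greatest _ j′≤x j′≤y)

module _ {A B : Set} {_≤A_ : A → A → Set} {_≤B_ : B → B → Set}
         (antisym : ∀ {x y} → x ≤B y → y ≤B x → x ≡ y) (f : A → B) where

  kernel-compatible : (∀ x y j → IsJoin _≤A_ x y j → IsJoin _≤B_ (f x) (f y) (f j)) →
                      (∀ x y j → IsMeet _≤A_ x y j → IsMeet _≤B_ (f x) (f y) (f j)) →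
                      CompatibleWithJoinsMeets _≤A_ (λ x y → f x ≡ f y)
  kernel-compatible f-joins f-meets =
    (λ x y z j j′ fx≡fy x∨z y∨z → join-unique antisym (subst (λ t → IsJoin _≤B_ t (f z) (f j)) fx≡fy (f-joins x z j x∨z))
                                                   (f-joins y z j′ y∨z)) ,
    (λ x y z j j′ fx≡fy x∧z y∧z → meet-unique antisym (subst (λ t → IsMeet _≤B_ t (f z) (f j)) fx≡fy (f-meets x z j x∧z))
                                                   (f-meets y z j′ y∧z))

Increasing : ∀ {n} → List (Fin n) → Set
Increasing = AllPairs Fin._<_

allFin-increasing : ∀ n → Increasing (allFin n)
allFin-increasing n = AllPairsₚ.tabulate⁺-< id

map-increasing : ∀ {n} {xs : List (Fin n)} (f : Fin n → Fin n) →
                 (∀ {x y} → x ∈ xs → y ∈ xs → x Fin.< y → f x Fin.< f y) →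
                 Increasing xs → Increasing (map f xs)
map-increasing f mono [] = []
map-increasing f mono (x<xs ∷ xs↑) =
  Allₚ.map⁺ (All.tabulate λ y∈xs → mono (here refl) (there y∈xs) (All.lookup x<xs y∈xs)) ∷
  map-increasing f (λ x∈ y∈ → mono (there x∈) (there y∈)) xs↑

private
  ⊆-tail : ∀ {n} {x : Fin n} {xs ys} → All (x Fin.<_) xs → x ∷ xs ⊆ x ∷ ys → xs ⊆ ys
  ⊆-tail x<xs sub z∈xs with sub (there z∈xs)
  ... | here refl = contradiction (All.lookup x<xs z∈xs) (<-irrefl refl)
  ... | there z∈ys = z∈ys

increasing-⊆-antisym : ∀ {n} {xs ys : List (Fin n)} → Increasing xs → Increasing ys →
                       xs ⊆ ys → ys ⊆ xs → xs ≡ ys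
increasing-⊆-antisym [] [] _ _ = refl
increasing-⊆-antisym [] (_ ∷ _) _ ys⊆ with ys⊆ (here refl)
... | ()
increasing-⊆-antisym (_ ∷ _) [] xs⊆ _ with xs⊆ (here refl)
... | ()
increasing-⊆-antisym {xs = x ∷ xs} {y ∷ ys} (x<xs ∷ xs↑) (y<ys ∷ ys↑) xs⊆ ys⊆
  with xs⊆ (here refl) | ys⊆ (here refl)
... | here refl | _ = cong (x ∷_)
  (increasing-⊆-antisym xs↑ ys↑ (⊆-tail x<xs xs⊆) (⊆-tail y<ys ys⊆))
... | there _ | here refl = cong (x ∷_)
  (increasing-⊆-antisym xs↑ ys↑ (⊆-tail x<xs xs⊆) (⊆-tail y<ys ys⊆))
... | there x∈ys | there y∈xs = contradiction (All.lookup y<ys x∈ys) (<-asym (All.lookup x<xs y∈xs))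

module _ {n : ℕ} {p : Level} {P : Pred (Fin n) p} (P? : U.Decidable P) where

  head-filter-just : ∀ {xs q} → Increasing xs → head (filter P? xs) ≡ just q →
                     P q × (∀ {r} → r ∈ xs → P r → toℕ q ≤ toℕ r)
  head-filter-just {x ∷ xs} (x<xs ∷ xs↑) eq with P? x
  head-filter-just {x ∷ xs} (x<xs ∷ xs↑) refl | yes px = px , least
    where
    least : ∀ {r} → r ∈ x ∷ xs → P r → toℕ x ≤ toℕ r
    least (here refl) _ = ≤-refl
    least (there r∈xs) _ = <⇒≤ (All.lookup x<xs r∈xs)
  head-filter-just {x ∷ xs} {q} (x<xs ∷ xs↑) eq | no ¬px = proj₁ (head-filter-just xs↑ eq) , least
    where
    least : ∀ {r} → r ∈ x ∷ xs → P r → toℕ q ≤ toℕ r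
    least (here refl) pr = contradiction pr ¬px
    least (there r∈xs) pr = proj₂ (head-filter-just xs↑ eq) r∈xs pr

  head-filter-nothing : ∀ {xs} → head (filter P? xs) ≡ nothing → ∀ {r} → r ∈ xs → ¬ P r
  head-filter-nothing {x ∷ xs} eq r∈ pr with P? x
  head-filter-nothing {x ∷ xs} () r∈ pr | yes _
  head-filter-nothing {x ∷ xs} eq (here refl) pr | no ¬px = ¬px pr
  head-filter-nothing {x ∷ xs} eq (there r∈xs) pr | no _ = head-filter-nothing eq r∈xs pr

count : ∀ {a p} {A : Set a} {P : Pred A p} → U.Decidable P → List A → ℕ
count P? [] = 0
count P? (x ∷ xs) with P? x
... | yes _ = suc (count P? xs)
... | no _ = count P? xs

module _ {a p q : Level} {A : Set a} {P : Pred A p} {Q : Pred A q}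
         (P? : U.Decidable P) (Q? : U.Decidable Q) (P⊆Q : P U.⊆ Q) where

  count-mono : ∀ xs → count P? xs ≤ count Q? xs
  count-mono [] = z≤n
  count-mono (x ∷ xs) with P? x | Q? x
  ... | yes _ | yes _ = s≤s (count-mono xs)
  ... | yes px | no ¬qx = contradiction (P⊆Q px) ¬qx
  ... | no _ | yes _ = m≤n⇒m≤1+n (count-mono xs)
  ... | no _ | no _ = count-mono xs

  count-mono-< : ∀ {x} xs → x ∈ xs → Q x → ¬ P x → count P? xs < count Q? xs
  count-mono-< (y ∷ xs) (here refl) qy ¬py with P? y | Q? y
  ... | yes py | _ = contradiction py ¬py
  ... | no _ | yes _ = s≤s (count-mono xs)
  ... | no _ | no ¬qy = contradiction qy ¬qy
  count-mono-< (y ∷ xs) (there x∈xs) qx ¬px with P? y | Q? y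
  ... | yes _ | yes _ = s≤s (count-mono-< xs x∈xs qx ¬px)
  ... | yes py | no ¬qy = contradiction (P⊆Q py) ¬qy
  ... | no _ | yes _ = m≤n⇒m≤1+n (count-mono-< xs x∈xs qx ¬px)
  ... | no _ | no _ = count-mono-< xs x∈xs qx ¬px

count-all : ∀ {a} {A : Set a} (xs : List A) → count U? xs ≡ length xs
count-all [] = refl
count-all (x ∷ xs) = cong suc (count-all xs)

count-none : ∀ {a p} {A : Set a} {P : Pred A p} (P? : U.Decidable P) →
             (∀ x → ¬ P x) → ∀ xs → count P? xs ≡ 0
count-none P? ¬P [] = refl
count-none P? ¬P (x ∷ xs) with P? x
... | yes px = contradiction px (¬P x)
... | no _ = count-none P? ¬P xs

injective⇒surjective : ∀ {n} {f : Fin n → Fin n} → Injective _≡_ _≡_ f → ∀ k → ∃ λ x → f x ≡ k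
injective⇒surjective {suc n} {f} f-inj k with Finₚ.any? (λ x → f x Finₚ.≟ k)
... | yes hit = hit
... | no miss = contradiction (Finₚ.injective⇒≤ punchOut∘f-injective) 1+n≰n
  where
  f≢k : ∀ x → f x ≢ k
  f≢k x fx≡k = miss (x , fx≡k)

  punchOut∘f-injective : Injective _≡_ _≡_ (λ x → punchOut (f≢k x ∘ sym))
  punchOut∘f-injective eq = f-inj (Finₚ.punchOut-injective (f≢k _ ∘ sym) (f≢k _ ∘ sym) eq)

module Ranking {n : ℕ} {_≺_ : Rel (Fin n) 0ℓ} (_≺?_ : ∀ x y → Dec (x ≺ y))
               (≺-irrefl : ∀ {x} → ¬ x ≺ x) (≺-trans : ∀ {x y z} → x ≺ y → y ≺ z → x ≺ z)
               (≺-connex : ∀ x y → x ≢ y → x ≺ y ⊎ y ≺ x) where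

  opaque
    rank : Fin n → ℕ
    rank x = count (_≺? x) (allFin n)

    ≺⇒rank< : ∀ {x y} → x ≺ y → rank x < rank y
    ≺⇒rank< {x} {y} x≺y =
      count-mono-< (_≺? x) (_≺? y) (λ z≺x → ≺-trans z≺x x≺y) (allFin n) (∈-allFin x) x≺y ≺-irrefl

    rank<n : ∀ x → rank x < n
    rank<n x = begin-strict
      rank x                 <⟨ count-mono-< (_≺? x) U? _ (allFin n) (∈-allFin x) _ ≺-irrefl ⟩
      count U? (allFin n)    ≡⟨ count-all (allFin n) ⟩
      length (allFin n)      ≡⟨ length-tabulate id ⟩
      n                      ∎
      where open ≤-Reasoning

    rankFin : Fin n → Fin n
    rankFin x = fromℕ< (rank<n x)

    toℕ-rankFin : ∀ x → toℕ (rankFin x) ≡ rank x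
    toℕ-rankFin x = Finₚ.toℕ-fromℕ< (rank<n x)

    rank<⇒≺ : ∀ {x y} → rank x < rank y → x ≺ y
    rank<⇒≺ {x} {y} rx<ry with x Finₚ.≟ y
    ... | yes refl = contradiction rx<ry (<-irrefl refl)
    ... | no x≢y with ≺-connex x y x≢y
    ...   | inj₁ x≺y = x≺y
    ...   | inj₂ y≺x = contradiction (≺⇒rank< y≺x) (<-asym rx<ry)

    rankFin-injective : Injective _≡_ _≡_ rankFin
    rankFin-injective {x} {y} eq with x Finₚ.≟ y
    ... | yes x≡y = x≡y
    ... | no x≢y = ⊥-elim ([ (λ x≺y → <⇒≢ (≺⇒rank< x≺y) rank-eq) , (λ y≺x → <⇒≢ (≺⇒rank< y≺x) (sym rank-eq)) ]′
                                (≺-connex x y x≢y))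
      where
      rank-eq : rank x ≡ rank y
      rank-eq = trans (sym (toℕ-rankFin x)) (trans (cong toℕ eq) (toℕ-rankFin y))

    ranking : Perm n
    ranking = mk↔ₛ′ rankFin (proj₁ ∘ surj) (proj₂ ∘ surj) (λ x → rankFin-injective (proj₂ (surj (rankFin x))))
      where
      surj : ∀ k → ∃ λ x → rankFin x ≡ k
      surj = injective⇒surjective rankFin-injective

    ≺⇒ranking< : ∀ {x y} → x ≺ y → Inverse.to ranking x Fin.< Inverse.to ranking y
    ≺⇒ranking< {x} {y} x≺y = subst₂ _<_ (sym (toℕ-rankFin x)) (sym (toℕ-rankFin y)) (≺⇒rank< x≺y)

    ranking<⇒≺ : ∀ {x y} → Inverse.to ranking x Fin.< Inverse.to ranking y → x ≺ y
    ranking<⇒≺ {x} {y} lt = rank<⇒≺ (subst₂ _<_ (toℕ-rankFin x) (toℕ-rankFin y) lt)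

    ranking-minimum : ∀ {x} → (∀ y → ¬ y ≺ x) → toℕ (Inverse.to ranking x) ≡ 0
    ranking-minimum {x} nothing≺x = trans (toℕ-rankFin x) (count-none (_≺? x) nothing≺x (allFin n))

module FromInversionSet (m : ℕ) {I : ℕ → ℕ → Set} (I? : ∀ p q → Dec (I p q))
  (¬I-from-0 : ∀ q → ¬ I 0 q)
  (I-trans : ∀ {p q r} → p < q → q < r → r < suc m → I p q → I q r → I p r)
  (¬I-trans : ∀ {p q r} → p < q → q < r → r < suc m → ¬ I p q → ¬ I q r → ¬ I p r) where

  private
    I-cotrans : ∀ {p q r} → p < q → q < r → r < suc m → I p r → I p q ⊎ I q r
    I-cotrans {p} {q} {r} p<q q<r r<n Ipr with I? p q | I? q r
    ... | yes Ipq | _ = inj₁ Ipq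
    ... | no _ | yes Iqr = inj₂ Iqr
    ... | no ¬Ipq | no ¬Iqr = contradiction Ipr (¬I-trans p<q q<r r<n ¬Ipq ¬Iqr)

    ¬I-cotrans : ∀ {p q r} → p < q → q < r → r < suc m → ¬ I p r → ¬ I p q ⊎ ¬ I q r
    ¬I-cotrans {p} {q} {r} p<q q<r r<n ¬Ipr with I? p q | I? q r
    ... | no ¬Ipq | _ = inj₁ ¬Ipq
    ... | yes _ | no ¬Iqr = inj₂ ¬Iqr
    ... | yes Ipq | yes Iqr = contradiction (I-trans p<q q<r r<n Ipq Iqr) ¬Ipr

  -- x ≺ y: the value at position x is smaller than the value at position y
  _≺_ : Fin (suc m) → Fin (suc m) → Set
  x ≺ y = (toℕ x < toℕ y × ¬ I (toℕ x) (toℕ y)) ⊎ (toℕ y < toℕ x × I (toℕ y) (toℕ x))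

  private
    _≺?_ : ∀ x y → Dec (x ≺ y)
    x ≺? y = ((toℕ x <? toℕ y) ×-dec ¬? (I? (toℕ x) (toℕ y)))
             ⊎-dec ((toℕ y <? toℕ x) ×-dec I? (toℕ y) (toℕ x))

    ≺-irrefl : ∀ {x} → ¬ x ≺ x
    ≺-irrefl (inj₁ (x<x , _)) = <-irrefl refl x<x
    ≺-irrefl (inj₂ (x<x , _)) = <-irrefl refl x<x

    ≺-trans : ∀ {x y z} → x ≺ y → y ≺ z → x ≺ z
    ≺-trans {z = z} (inj₁ (x<y , ¬Ixy)) (inj₁ (y<z , ¬Iyz)) =
      inj₁ (<-trans x<y y<z , ¬I-trans x<y y<z (Finₚ.toℕ<n z) ¬Ixy ¬Iyz)
    ≺-trans {x = x} (inj₂ (y<x , Iyx)) (inj₂ (z<y , Izy)) =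
      inj₂ (<-trans z<y y<x , I-trans z<y y<x (Finₚ.toℕ<n x) Izy Iyx)
    ≺-trans {x} {y} {z} (inj₁ (x<y , ¬Ixy)) (inj₂ (z<y , Izy)) with <-cmp (toℕ x) (toℕ z)
    ... | tri< x<z _ _ = [ (λ ¬Ixz → inj₁ (x<z , ¬Ixz)) , (λ ¬Izy → contradiction Izy ¬Izy) ]′
                           (¬I-cotrans x<z z<y (Finₚ.toℕ<n y) ¬Ixy)
    ... | tri≈ _ x≡z _ = contradiction (subst (λ k → I k (toℕ y)) (sym x≡z) Izy) ¬Ixy
    ... | tri> _ _ z<x = [ (λ Izx → inj₂ (z<x , Izx)) , (λ Ixy → contradiction Ixy ¬Ixy) ]′
                           (I-cotrans z<x x<y (Finₚ.toℕ<n y) Izy)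
    ≺-trans {x} {y} {z} (inj₂ (y<x , Iyx)) (inj₁ (y<z , ¬Iyz)) with <-cmp (toℕ x) (toℕ z)
    ... | tri< x<z _ _ = [ (λ ¬Iyx → contradiction Iyx ¬Iyx) , (λ ¬Ixz → inj₁ (x<z , ¬Ixz)) ]′
                           (¬I-cotrans y<x x<z (Finₚ.toℕ<n z) ¬Iyz)
    ... | tri≈ _ x≡z _ = contradiction (subst (I (toℕ y)) x≡z Iyx) ¬Iyz
    ... | tri> _ _ z<x = [ (λ Iyz → contradiction Iyz ¬Iyz) , (λ Izx → inj₂ (z<x , Izx)) ]′
                           (I-cotrans y<z z<x (Finₚ.toℕ<n x) Iyx)

    ≺-connex : ∀ x y → x ≢ y → x ≺ y ⊎ y ≺ x
    ≺-connex x y x≢y with <-cmp (toℕ x) (toℕ y)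
    ... | tri≈ _ x≡y _ = contradiction (Finₚ.toℕ-injective x≡y) x≢y
    ... | tri< x<y _ _ with I? (toℕ x) (toℕ y)
    ...   | yes Ixy = inj₂ (inj₂ (x<y , Ixy))
    ...   | no ¬Ixy = inj₁ (inj₁ (x<y , ¬Ixy))
    ≺-connex x y x≢y | tri> _ _ y<x with I? (toℕ y) (toℕ x)
    ...   | yes Iyx = inj₁ (inj₂ (y<x , Iyx))
    ...   | no ¬Iyx = inj₂ (inj₁ (y<x , ¬Iyx))

    open Ranking _≺?_ ≺-irrefl ≺-trans ≺-connex

  permutation : S1×S (suc m)
  permutation = ranking , Finₚ.toℕ-injective (ranking-minimum nothing≺0)
    where
    nothing≺0 : ∀ y → ¬ y ≺ Fin.zero
    nothing≺0 y (inj₂ (_ , I0y)) = ¬I-from-0 _ I0y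

  isInversion⇒I : ∀ i j → IsInversion (proj₁ permutation) i j → I (toℕ i) (toℕ j)
  isInversion⇒I i j (i<j , πj<πi) with ranking<⇒≺ πj<πi
  ... | inj₁ (j<i , _) = contradiction i<j (<-asym j<i)
  ... | inj₂ (_ , Iij) = Iij

  I⇒isInversion : ∀ i j → toℕ i < toℕ j → I (toℕ i) (toℕ j) → IsInversion (proj₁ permutation) i j
  I⇒isInversion i j i<j Iij = i<j , ≺⇒ranking< (inj₂ (i<j , Iij))

-- u p is the end of the arc starting at position p ∈ 1 … m; the end suc m stands for the root.
InRange : ℕ → (ℕ → ℕ) → Set
InRange m u = ∀ p → 1 ≤ p → p ≤ m → p < u p × u p ≤ suc m

NonCrossing : ℕ → (ℕ → ℕ) → Set
NonCrossing m u = ∀ p r → 1 ≤ p → p < r → r ≤ m → r < u p → u r ≤ u p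

_≤[_]_ : (ℕ → ℕ) → ℕ → (ℕ → ℕ) → Set
u ≤[ m ] v = ∀ p → 1 ≤ p → p ≤ m → u p ≤ v p

_≗[_]_ : (ℕ → ℕ) → ℕ → (ℕ → ℕ) → Set
u ≗[ m ] v = ∀ p → 1 ≤ p → p ≤ m → u p ≡ v p

≗[]-sym : ∀ {m u v} → u ≗[ m ] v → v ≗[ m ] u
≗[]-sym u≗v p 1≤p p≤m = sym (u≗v p 1≤p p≤m)

≤[]-resp-≗ : ∀ {m u u′ v v′} → u ≗[ m ] u′ → v ≗[ m ] v′ → u ≤[ m ] v → u′ ≤[ m ] v′
≤[]-resp-≗ u≗u′ v≗v′ u≤v p 1≤p p≤m = subst₂ _≤_ (u≗u′ p 1≤p p≤m) (v≗v′ p 1≤p p≤m) (u≤v p 1≤p p≤m)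

⊓-inRange : ∀ {m u v} → InRange m u → InRange m v → InRange m (λ p → u p ⊓ v p)
⊓-inRange u-range v-range p 1≤p p≤m =
  ⊓-glb (proj₁ (u-range p 1≤p p≤m)) (proj₁ (v-range p 1≤p p≤m)) ,
  ≤-trans (m⊓n≤m _ _) (proj₂ (u-range p 1≤p p≤m))

⊓-nonCrossing : ∀ {m u v} → NonCrossing m u → NonCrossing m v → NonCrossing m (λ p → u p ⊓ v p)
⊓-nonCrossing u-nc v-nc p r 1≤p p<r r≤m r<arc =
  ⊓-mono-≤ (u-nc p r 1≤p p<r r≤m (<-≤-trans r<arc (m⊓n≤m _ _)))
           (v-nc p r 1≤p p<r r≤m (<-≤-trans r<arc (m⊓n≤n _ _)))

data Split (b : ℕ) : ℕ → Set where
  inRight : ∀ {p} → p ≤ b → Split b p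
  atRoot  : Split b (suc b)
  inLeft  : ∀ p → Split b (suc b + suc p)

split : ∀ b p → Split b p
split zero zero = inRight z≤n
split zero (suc zero) = atRoot
split zero (suc (suc p)) = inLeft p
split (suc b) zero = inRight z≤n
split (suc b) (suc p) with split b p
... | inRight p≤b = inRight (s≤s p≤b)
... | atRoot = atRoot
... | inLeft q = inLeft q

-- Nodes of bin A B are numbered: those of B, then the root, then those of A.
-- arcs t p is p + 1 + the size of the left subtree of node p (a bracket vector of t).
mutual
  arcs : BTree → ℕ → ℕ
  arcs leaf p = 0
  arcs (bin A B) p = arcsBin A B p (split (nodes B) p)

  arcsBin : BTree → (B : BTree) → (p : ℕ) → Split (nodes B) p → ℕ
  arcsBin A B p (inRight _) = arcs B p
  arcsBin A B _ atRoot = suc (nodes (bin A B))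
  arcsBin A B _ (inLeft p) = suc (nodes B) + arcs A (suc p)

private
  split-inRight : ∀ b p (p≤b : p ≤ b) → split b p ≡ inRight p≤b
  split-inRight zero zero z≤n = refl
  split-inRight (suc b) zero z≤n = refl
  split-inRight (suc b) (suc p) (s≤s p≤b) rewrite split-inRight b p p≤b = refl

  split-atRoot : ∀ b → split b (suc b) ≡ atRoot
  split-atRoot zero = refl
  split-atRoot (suc b) rewrite split-atRoot b = refl

  split-inLeft : ∀ b p → split b (suc b + suc p) ≡ inLeft p
  split-inLeft zero p = refl
  split-inLeft (suc b) p rewrite split-inLeft b p = refl

arcs-inRight : ∀ A B {p} → p ≤ nodes B → arcs (bin A B) p ≡ arcs B p
arcs-inRight A B {p} p≤b rewrite split-inRight (nodes B) p p≤b = refl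

arcs-atRoot : ∀ A B → arcs (bin A B) (suc (nodes B)) ≡ suc (nodes (bin A B))
arcs-atRoot A B rewrite split-atRoot (nodes B) = refl

arcs-inLeft : ∀ A B p → arcs (bin A B) (suc (nodes B) + suc p) ≡ suc (nodes B) + arcs A (suc p)
arcs-inLeft A B p rewrite split-inLeft (nodes B) p = refl

private
  inRight-bound : ∀ A B → nodes B ≤ nodes (bin A B)
  inRight-bound A B = m≤n⇒m≤1+n (m≤n+m (nodes B) (nodes A))

  root-bound : ∀ A B → suc (nodes B) ≤ nodes (bin A B)
  root-bound A B = s≤s (m≤n+m (nodes B) (nodes A))

  inLeft-position : ∀ A B {q} → suc q ≤ nodes A → suc (nodes B) + suc q ≤ nodes (bin A B)
  inLeft-position A B {q} q<a = subst (suc (nodes B) + suc q ≤_) (cong suc (+-comm (nodes B) (nodes A))) (+-monoʳ-≤ (suc (nodes B)) q<a)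

  inLeft-bound : ∀ A B {q} → suc (nodes B) + suc q ≤ nodes (bin A B) → suc q ≤ nodes A
  inLeft-bound A B {q} le = +-cancelˡ-≤ (suc (nodes B)) _ _
    (subst (suc (nodes B) + suc q ≤_) (cong suc (+-comm (nodes A) (nodes B))) le)

  inLeft-split : ∀ b p → suc b < p → ∃ λ q → p ≡ suc b + suc q
  inLeft-split b p b<p with m≤n⇒∃[o]m+o≡n b<p
  ... | q , eq = q , trans (sym eq) (sym (+-suc (suc b) q))

arcs-inRange : ∀ t → InRange (nodes t) (arcs t)
arcs-inRange leaf zero () _
arcs-inRange (bin A B) p 1≤p p≤n with split (nodes B) p
... | inRight p≤b with arcs-inRange B p 1≤p p≤b
...   | p<arc , arc≤ = p<arc , ≤-trans arc≤ (s≤s (inRight-bound A B))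
arcs-inRange (bin A B) p 1≤p p≤n | atRoot = s≤s (root-bound A B) , ≤-refl
arcs-inRange (bin A B) p 1≤p p≤n | inLeft q with arcs-inRange A (suc q) (s≤s z≤n) (inLeft-bound A B p≤n)
...   | p<arc , arc≤ = +-monoʳ-< (suc (nodes B)) p<arc ,
                       ≤-trans (+-monoʳ-≤ (suc (nodes B)) arc≤)
                               (≤-reflexive (cong suc (trans (+-suc (nodes B) (nodes A)) (cong suc (+-comm (nodes B) (nodes A))))))

arcs-nonCrossing : ∀ t → NonCrossing (nodes t) (arcs t)
arcs-nonCrossing leaf p zero _ () _ _
arcs-nonCrossing (bin A B) p r 1≤p p<r r≤n r<arc with split (nodes B) p
... | inRight p≤b = subst (_≤ arcs B p) (sym (arcs-inRight A B r≤b)) (arcs-nonCrossing B p r 1≤p p<r r≤b r<arc)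
  where
  r≤b : r ≤ nodes B
  r≤b = ≤-pred (≤-trans r<arc (proj₂ (arcs-inRange B p 1≤p p≤b)))
... | atRoot = proj₂ (arcs-inRange (bin A B) r (≤-trans 1≤p (<⇒≤ p<r)) r≤n)
... | inLeft q with inLeft-split (nodes B) r (<-trans (m<m+n (suc (nodes B)) z<s) p<r)
...   | r′ , refl = subst (_≤ _) (sym (arcs-inLeft A B r′)) (+-monoʳ-≤ (suc (nodes B))
          (arcs-nonCrossing A (suc q) (suc r′) (s≤s z≤n) (+-cancelˡ-< (suc (nodes B)) _ _ p<r)
                            (inLeft-bound A B r≤n) (+-cancelˡ-< (suc (nodes B)) _ _ r<arc)))

rot-nodes : ∀ {s t} → Rot s t → nodes s ≡ nodes t
rot-nodes (rot X Y Z) = nodes≡ (nodes X) (nodes Y) (nodes Z)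
  where
  nodes≡ : ∀ x y z → suc (suc (x + y) + z) ≡ suc (x + suc (y + z))
  nodes≡ = solve-∀
rot-nodes (left B r) = cong (λ a → suc (a + nodes B)) (rot-nodes r)
rot-nodes (right A r) = cong (λ b → suc (nodes A + b)) (rot-nodes r)

star-rot-nodes : ∀ {s t} → Star Rot s t → nodes s ≡ nodes t
star-rot-nodes ε = refl
star-rot-nodes (r ◅ rs) = trans (rot-nodes r) (star-rot-nodes rs)

private
  arc≤root : ∀ s t → nodes s ≡ nodes t → ∀ {p} → 1 ≤ p → p ≤ nodes s → arcs t p ≤ suc (nodes s)
  arc≤root s t s≡t 1≤p p≤s rewrite s≡t = proj₂ (arcs-inRange t _ 1≤p p≤s)

rotation-arcs : ∀ X Y Z → arcs (bin X (bin Y Z)) ≤[ nodes (bin (bin X Y) Z) ] arcs (bin (bin X Y) Z)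
rotation-arcs X Y Z p 1≤p p≤n with split (nodes Z) p
... | inRight p≤z = ≤-reflexive (trans (arcs-inRight X (bin Y Z) (≤-trans p≤z (inRight-bound Y Z)))
                                       (arcs-inRight Y Z p≤z))
... | atRoot = arc≤root (bin (bin X Y) Z) (bin X (bin Y Z)) (rot-nodes (rot X Y Z)) 1≤p p≤n
... | inLeft q with split (nodes Y) (suc q)
...   | inRight q<y = ≤-reflexive (trans (arcs-inRight X (bin Y Z) (inLeft-position Y Z q<y)) (arcs-inLeft Y Z q))
...   | atRoot = subst (arcs (bin X (bin Y Z)) p ≤_) (root≡ (nodes X) (nodes Y) (nodes Z))
                       (arc≤root (bin (bin X Y) Z) (bin X (bin Y Z)) (rot-nodes (rot X Y Z)) 1≤p p≤n)
  where
  root≡ : ∀ x y z → suc (suc (suc (x + y) + z)) ≡ suc z + suc (suc (x + y))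
  root≡ = solve-∀
...   | inLeft q′ = ≤-reflexive (begin
  arcs (bin X (bin Y Z)) (suc (nodes Z) + suc (nodes Y + suc q′))
    ≡⟨ cong (arcs (bin X (bin Y Z))) (position≡ (nodes Y) (nodes Z) q′) ⟩
  arcs (bin X (bin Y Z)) (suc (nodes (bin Y Z)) + suc q′)
    ≡⟨ arcs-inLeft X (bin Y Z) q′ ⟩
  suc (nodes (bin Y Z)) + arcs X (suc q′)
    ≡⟨ value≡ (nodes Y) (nodes Z) (arcs X (suc q′)) ⟩
  suc (nodes Z) + (suc (nodes Y) + arcs X (suc q′)) ∎)
  where
  open ≡-Reasoning
  position≡ : ∀ y z q → suc z + suc (y + suc q) ≡ suc (suc (y + z)) + suc q
  position≡ = solve-∀
  value≡ : ∀ y z w → suc (suc (y + z)) + w ≡ suc z + (suc y + w)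
  value≡ = solve-∀

rot⇒arcs-≥ : ∀ {s t} → Rot s t → arcs t ≤[ nodes s ] arcs s
rot⇒arcs-≥ (rot X Y Z) = rotation-arcs X Y Z
rot⇒arcs-≥ (left B r) p 1≤p p≤n with split (nodes B) p
... | inRight _ = ≤-refl
... | atRoot = ≤-reflexive (cong (λ a → suc (suc (a + nodes B))) (sym (rot-nodes r)))
... | inLeft q = +-monoʳ-≤ (suc (nodes B)) (rot⇒arcs-≥ r (suc q) (s≤s z≤n) (inLeft-bound _ B p≤n))
rot⇒arcs-≥ (right A {B} {B′} r) p 1≤p p≤n with split (nodes B) p
... | inRight p≤b = subst (_≤ arcs B p) (sym (arcs-inRight A B′ (subst (p ≤_) (rot-nodes r) p≤b)))
                          (rot⇒arcs-≥ r p 1≤p p≤b)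
... | atRoot = arc≤root (bin A B) (bin A B′) (rot-nodes (right A r)) 1≤p p≤n
... | inLeft q = ≤-reflexive (begin
  arcs (bin A B′) (suc (nodes B) + suc q)   ≡⟨ cong (λ b → arcs (bin A B′) (suc b + suc q)) (rot-nodes r) ⟩
  arcs (bin A B′) (suc (nodes B′) + suc q)  ≡⟨ arcs-inLeft A B′ q ⟩
  suc (nodes B′) + arcs A (suc q)           ≡⟨ cong (λ b → suc b + arcs A (suc q)) (sym (rot-nodes r)) ⟩
  suc (nodes B) + arcs A (suc q)            ∎)
  where open ≡-Reasoning

star-rot⇒arcs-≥ : ∀ {s t} → Star Rot s t → arcs t ≤[ nodes s ] arcs s
star-rot⇒arcs-≥ ε p 1≤p p≤n = ≤-refl
star-rot⇒arcs-≥ (r ◅ rs) p 1≤p p≤n =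
  ≤-trans (star-rot⇒arcs-≥ rs p 1≤p (subst (p ≤_) (rot-nodes r) p≤n)) (rot⇒arcs-≥ r p 1≤p p≤n)

record RotatesToRoot (s : BTree) (q : ℕ) : Set where
  field
    leftSubtree rightSubtree : BTree
    right-size  : suc (nodes rightSubtree) ≡ q
    rotations   : Star Rot s (bin leftSubtree rightSubtree)
    arcs-below  : ∀ p → p < q → arcs (bin leftSubtree rightSubtree) p ≡ arcs s p ⊎ arcs (bin leftSubtree rightSubtree) p ≡ q
    arcs-above  : ∀ p → q < p → arcs (bin leftSubtree rightSubtree) p ≡ arcs s p

module _ (A B : BTree) (q : ℕ) (A↑ : RotatesToRoot A (suc q)) where
  open RotatesToRoot A↑ renaming (leftSubtree to A₁; rightSubtree to B₁)

  private
    q≡ : nodes B₁ ≡ q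
    q≡ = suc-injective right-size

    size≡ : suc (nodes (bin B₁ B)) ≡ suc (nodes B) + suc q
    size≡ = trans (cong (λ k → suc (suc (k + nodes B))) q≡) (sizes≡ q (nodes B))
      where
      sizes≡ : ∀ q b → suc (suc (q + b)) ≡ suc b + suc q
      sizes≡ = solve-∀

    below : ∀ p → p < suc (nodes B) + suc q →
            arcs (bin A₁ (bin B₁ B)) p ≡ arcs (bin A B) p ⊎ arcs (bin A₁ (bin B₁ B)) p ≡ suc (nodes B) + suc q
    below p p<q with split (nodes B) p
    ... | inRight p≤b = inj₁ (trans (arcs-inRight A₁ (bin B₁ B) (≤-trans p≤b (inRight-bound B₁ B)))
                                    (arcs-inRight B₁ B p≤b))
    ... | atRoot = inj₂ (trans (arcs-inRight A₁ (bin B₁ B) (root-bound B₁ B)) (trans (arcs-atRoot B₁ B) size≡))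
    ... | inLeft p′ = [ inj₁ ∘ shifted , inj₂ ∘ shifted ]′ (arcs-below (suc p′) (+-cancelˡ-< (suc (nodes B)) _ _ p<q))
      where
      arc≡ : arcs (bin A₁ (bin B₁ B)) (suc (nodes B) + suc p′) ≡ suc (nodes B) + arcs (bin A₁ B₁) (suc p′)
      arc≡ = begin
        arcs (bin A₁ (bin B₁ B)) (suc (nodes B) + suc p′)
          ≡⟨ arcs-inRight A₁ (bin B₁ B) (≤-pred (subst (suc (nodes B) + suc p′ <_) (sym size≡) p<q)) ⟩
        arcs (bin B₁ B) (suc (nodes B) + suc p′)
          ≡⟨ arcs-inLeft B₁ B p′ ⟩
        suc (nodes B) + arcs B₁ (suc p′)
          ≡⟨ cong (suc (nodes B) +_) (sym (arcs-inRight A₁ B₁ p′<b₁)) ⟩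
        suc (nodes B) + arcs (bin A₁ B₁) (suc p′) ∎
        where
        open ≡-Reasoning
        p′<b₁ : suc p′ ≤ nodes B₁
        p′<b₁ = ≤-pred (subst (suc p′ <_) (sym right-size) (+-cancelˡ-< (suc (nodes B)) _ _ p<q))
      shifted : ∀ {v} → arcs (bin A₁ B₁) (suc p′) ≡ v → arcs (bin A₁ (bin B₁ B)) (suc (nodes B) + suc p′) ≡ suc (nodes B) + v
      shifted eq = trans arc≡ (cong (suc (nodes B) +_) eq)

    above : ∀ p → suc (nodes B) + suc q < p → arcs (bin A₁ (bin B₁ B)) p ≡ arcs (bin A B) p
    above p q<p with inLeft-split (nodes B) p (<-trans (m<m+n (suc (nodes B)) z<s) q<p)
    ... | p′ , refl with inLeft-split (nodes B₁) (suc p′) (subst (_< suc p′) (sym right-size) q<p′)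
      where
      q<p′ : suc q < suc p′
      q<p′ = +-cancelˡ-< (suc (nodes B)) _ _ q<p
    ...   | p″ , p′≡ = begin
      arcs (bin A₁ (bin B₁ B)) (suc (nodes B) + suc p′)
        ≡⟨ cong (λ k → arcs (bin A₁ (bin B₁ B)) (suc (nodes B) + k)) p′≡ ⟩
      arcs (bin A₁ (bin B₁ B)) (suc (nodes B) + (suc (nodes B₁) + suc p″))
        ≡⟨ cong (arcs (bin A₁ (bin B₁ B))) (position≡ (nodes B) (nodes B₁) p″) ⟩
      arcs (bin A₁ (bin B₁ B)) (suc (nodes (bin B₁ B)) + suc p″)
        ≡⟨ arcs-inLeft A₁ (bin B₁ B) p″ ⟩
      suc (nodes (bin B₁ B)) + arcs A₁ (suc p″)
        ≡⟨ value≡ (nodes B) (nodes B₁) (arcs A₁ (suc p″)) ⟩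
      suc (nodes B) + (suc (nodes B₁) + arcs A₁ (suc p″))
        ≡⟨ cong (suc (nodes B) +_) (sym (arcs-inLeft A₁ B₁ p″)) ⟩
      suc (nodes B) + arcs (bin A₁ B₁) (suc (nodes B₁) + suc p″)
        ≡⟨ cong (λ k → suc (nodes B) + arcs (bin A₁ B₁) k) (sym p′≡) ⟩
      suc (nodes B) + arcs (bin A₁ B₁) (suc p′)
        ≡⟨ cong (suc (nodes B) +_) (arcs-above (suc p′) (+-cancelˡ-< (suc (nodes B)) _ _ q<p)) ⟩
      suc (nodes B) + arcs A (suc p′)
        ≡⟨ sym (arcs-inLeft A B p′) ⟩
      arcs (bin A B) (suc (nodes B) + suc p′) ∎
      where
      open ≡-Reasoning
      position≡ : ∀ b b₁ p → suc b + (suc b₁ + suc p) ≡ suc (suc (b₁ + b)) + suc p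
      position≡ = solve-∀
      value≡ : ∀ b b₁ w → suc (suc (b₁ + b)) + w ≡ suc b + (suc b₁ + w)
      value≡ = solve-∀

  rotatesToRoot-inLeft : RotatesToRoot (bin A B) (suc (nodes B) + suc q)
  rotatesToRoot-inLeft = record
    { leftSubtree = A₁
    ; rightSubtree = bin B₁ B
    ; right-size = size≡
    ; rotations = gmap (λ X → bin X B) (left B) rotations ◅◅ (rot A₁ B₁ B ◅ ε)
    ; arcs-below = below
    ; arcs-above = above
    }

rotatesToRoot : ∀ s q → 1 ≤ q → q ≤ nodes s → arcs s q ≡ suc (nodes s) → RotatesToRoot s q
rotatesToRoot (bin A B) q 1≤q q≤n arc≡ with split (nodes B) q
... | inRight q≤b = contradiction (subst (_≤ suc (nodes B)) arc≡ (proj₂ (arcs-inRange B q 1≤q q≤b)))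
                                  (<⇒≱ (s≤s (root-bound A B)))
... | atRoot = record
  { leftSubtree = A ; rightSubtree = B ; right-size = refl ; rotations = ε
  ; arcs-below = λ _ _ → inj₁ refl ; arcs-above = λ _ _ → refl }
... | inLeft q′ = rotatesToRoot-inLeft A B q′
  (rotatesToRoot A (suc q′) (s≤s z≤n) (inLeft-bound A B q≤n) (+-cancelˡ-≡ (suc (nodes B)) _ _ (trans arc≡ (max≡ (nodes A) (nodes B)))))
  where
  max≡ : ∀ a b → suc (suc (a + b)) ≡ suc b + suc a
  max≡ = solve-∀

arcs-≥⇒star-rot : ∀ s t → nodes s ≡ nodes t → arcs t ≤[ nodes t ] arcs s → Star Rot s t
arcs-≥⇒star-rot leaf leaf _ _ = ε
arcs-≥⇒star-rot s (bin A B) s≡t t≤s =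
  rotations ◅◅ gmap (λ X → bin X B*) (left B*) (arcs-≥⇒star-rot A* A A*-size A≤A*)
            ◅◅ gmap (bin A) (right A) (arcs-≥⇒star-rot B* B B*-size B≤B*)
  where
  q≤s : suc (nodes B) ≤ nodes s
  q≤s = subst (suc (nodes B) ≤_) (sym s≡t) (root-bound A B)

  arc-max : arcs s (suc (nodes B)) ≡ suc (nodes s)
  arc-max = ≤-antisym (proj₂ (arcs-inRange s _ (s≤s z≤n) q≤s))
    (subst (_≤ arcs s (suc (nodes B))) (trans (arcs-atRoot A B) (cong suc (sym s≡t)))
           (t≤s _ (s≤s z≤n) (root-bound A B)))

  open RotatesToRoot (rotatesToRoot s (suc (nodes B)) (s≤s z≤n) q≤s arc-max)
    renaming (leftSubtree to A*; rightSubtree to B*)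

  B*-size : nodes B* ≡ nodes B
  B*-size = suc-injective right-size

  A*-size : nodes A* ≡ nodes A
  A*-size = +-cancelʳ-≡ (nodes B) _ _ (begin
    nodes A* + nodes B   ≡⟨ cong (nodes A* +_) (sym B*-size) ⟩
    nodes A* + nodes B*  ≡⟨ suc-injective (trans (sym (star-rot-nodes rotations)) s≡t) ⟩
    nodes A + nodes B    ∎)
    where open ≡-Reasoning

  B≤B* : arcs B ≤[ nodes B ] arcs B*
  B≤B* p 1≤p p≤b = [ unchanged , rooted ]′ (arcs-below p (s≤s p≤b))
    where
    arc*≡ : arcs (bin A* B*) p ≡ arcs B* p
    arc*≡ = arcs-inRight A* B* (subst (p ≤_) (sym B*-size) p≤b)

    unchanged : arcs (bin A* B*) p ≡ arcs s p → arcs B p ≤ arcs B* p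
    unchanged arc*≡arc = begin
      arcs B p          ≡⟨ sym (arcs-inRight A B p≤b) ⟩
      arcs (bin A B) p  ≤⟨ t≤s p 1≤p (≤-trans p≤b (inRight-bound A B)) ⟩
      arcs s p          ≡⟨ sym arc*≡arc ⟩
      arcs (bin A* B*) p ≡⟨ arc*≡ ⟩
      arcs B* p         ∎
      where open ≤-Reasoning

    rooted : arcs (bin A* B*) p ≡ suc (nodes B) → arcs B p ≤ arcs B* p
    rooted arc*≡root = subst (arcs B p ≤_) (trans (sym arc*≡root) arc*≡) (proj₂ (arcs-inRange B p 1≤p p≤b))

  A≤A* : arcs A ≤[ nodes A ] arcs A*
  A≤A* (suc p) _ p≤a = +-cancelˡ-≤ (suc (nodes B)) _ _ (begin
    suc (nodes B) + arcs A (suc p)             ≡⟨ sym (arcs-inLeft A B p) ⟩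
    arcs (bin A B) (suc (nodes B) + suc p)     ≤⟨ t≤s _ (s≤s z≤n) (inLeft-position A B p≤a) ⟩
    arcs s (suc (nodes B) + suc p)             ≡⟨ sym (arcs-above _ (m<m+n (suc (nodes B)) z<s)) ⟩
    arcs (bin A* B*) (suc (nodes B) + suc p)   ≡⟨ cong (λ b → arcs (bin A* B*) (suc b + suc p)) (sym B*-size) ⟩
    arcs (bin A* B*) (suc (nodes B*) + suc p)  ≡⟨ arcs-inLeft A* B* p ⟩
    suc (nodes B*) + arcs A* (suc p)           ≡⟨ cong (λ b → suc b + arcs A* (suc p)) B*-size ⟩
    suc (nodes B) + arcs A* (suc p)            ∎)
    where open ≤-Reasoning

private
  arc-inRight<root : ∀ A B {p} → 1 ≤ p → p ≤ nodes B → arcs (bin A B) p < suc (nodes (bin A B))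
  arc-inRight<root A B 1≤p p≤b = subst (_< _) (sym (arcs-inRight A B p≤b))
    (s≤s (≤-trans (proj₂ (arcs-inRange B _ 1≤p p≤b)) (root-bound A B)))

  root-position-≤ : ∀ A B A′ B′ → nodes (bin A B) ≡ nodes (bin A′ B′) →
                    arcs (bin A B) ≗[ nodes (bin A B) ] arcs (bin A′ B′) → nodes B ≤ nodes B′
  root-position-≤ A B A′ B′ n≡n′ arcs≡ with nodes B ≤? nodes B′
  ... | yes b≤b′ = b≤b′
  ... | no b≰b′ = contradiction (begin
          suc (nodes (bin A B))              ≡⟨ cong suc n≡n′ ⟩
          suc (nodes (bin A′ B′))            ≡⟨ sym (arcs-atRoot A′ B′) ⟩
          arcs (bin A′ B′) (suc (nodes B′))  ≡⟨ sym (arcs≡ _ (s≤s z≤n) (≤-trans b′<b (inRight-bound A B))) ⟩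
          arcs (bin A B) (suc (nodes B′))    ∎)
        (>⇒≢ (arc-inRight<root A B (s≤s z≤n) b′<b))
    where
    open ≡-Reasoning
    b′<b : suc (nodes B′) ≤ nodes B
    b′<b = ≰⇒> b≰b′

arcs-injective : ∀ s t → nodes s ≡ nodes t → arcs s ≗[ nodes s ] arcs t → s ≡ t
arcs-injective leaf leaf _ _ = refl
arcs-injective (bin A B) (bin A′ B′) n≡n′ arcs≡ =
  cong₂ bin (arcs-injective A A′ a≡a′ A≗A′) (arcs-injective B B′ b≡b′ B≗B′)
  where
  arcs≡′ : arcs (bin A′ B′) ≗[ nodes (bin A′ B′) ] arcs (bin A B)
  arcs≡′ p 1≤p p≤n = sym (arcs≡ p 1≤p (subst (p ≤_) (sym n≡n′) p≤n))

  b≡b′ : nodes B ≡ nodes B′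
  b≡b′ = ≤-antisym (root-position-≤ A B A′ B′ n≡n′ arcs≡) (root-position-≤ A′ B′ A B (sym n≡n′) arcs≡′)

  a≡a′ : nodes A ≡ nodes A′
  a≡a′ = +-cancelʳ-≡ (nodes B) _ _ (trans (suc-injective n≡n′) (cong (nodes A′ +_) (sym b≡b′)))

  B≗B′ : arcs B ≗[ nodes B ] arcs B′
  B≗B′ p 1≤p p≤b = begin
    arcs B p            ≡⟨ sym (arcs-inRight A B p≤b) ⟩
    arcs (bin A B) p    ≡⟨ arcs≡ p 1≤p (≤-trans p≤b (inRight-bound A B)) ⟩
    arcs (bin A′ B′) p  ≡⟨ arcs-inRight A′ B′ (subst (p ≤_) b≡b′ p≤b) ⟩
    arcs B′ p           ∎
    where open ≡-Reasoning

  A≗A′ : arcs A ≗[ nodes A ] arcs A′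
  A≗A′ (suc p) _ p≤a = +-cancelˡ-≡ (suc (nodes B)) _ _ (begin
    suc (nodes B) + arcs A (suc p)             ≡⟨ sym (arcs-inLeft A B p) ⟩
    arcs (bin A B) (suc (nodes B) + suc p)     ≡⟨ arcs≡ _ (s≤s z≤n) (inLeft-position A B p≤a) ⟩
    arcs (bin A′ B′) (suc (nodes B) + suc p)   ≡⟨ cong (λ b → arcs (bin A′ B′) (suc b + suc p)) b≡b′ ⟩
    arcs (bin A′ B′) (suc (nodes B′) + suc p)  ≡⟨ arcs-inLeft A′ B′ p ⟩
    suc (nodes B′) + arcs A′ (suc p)           ≡⟨ cong (λ b → suc b + arcs A′ (suc p)) (sym b≡b′) ⟩
    suc (nodes B) + arcs A′ (suc p)            ∎)
    where open ≡-Reasoning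

toBTree : List PTree → BTree
toBTree [] = leaf
toBTree (node cs ∷ ts) = bin (toBTree ts) (toBTree cs)

toForest : BTree → List PTree
toForest leaf = []
toForest (bin A B) = node (toForest B) ∷ toForest A

nodes-toBTree : ∀ ts → nodes (toBTree ts) ≡ sizes ts
nodes-toBTree [] = refl
nodes-toBTree (node cs ∷ ts) =
  cong suc (trans (cong₂ _+_ (nodes-toBTree ts) (nodes-toBTree cs)) (+-comm (sizes ts) (sizes cs)))

toBTree-toForest : ∀ t → toBTree (toForest t) ≡ t
toBTree-toForest leaf = refl
toBTree-toForest (bin A B) = cong₂ bin (toBTree-toForest A) (toBTree-toForest B)

toForest-toBTree : ∀ ts → toForest (toBTree ts) ≡ ts
toForest-toBTree [] = refl
toForest-toBTree (node cs ∷ ts) = cong₂ (λ cs′ ts′ → node cs′ ∷ ts′) (toForest-toBTree cs) (toForest-toBTree ts)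

sized-≡ : ∀ {A : Set} {size : A → ℕ} {k} {a a′ : A} {p : size a ≡ k} {p′ : size a′ ≡ k} →
          a ≡ a′ → _≡_ {A = Σ A (λ x → size x ≡ k)} (a , p) (a′ , p′)
sized-≡ {p = p} {p′} refl = cong (_ ,_) (≡-irrelevant p p′)

module _ (m : ℕ) where

  plane→tamari : Plane (suc m) → Tamari m
  plane→tamari (node cs , size≡) = toBTree cs , trans (nodes-toBTree cs) (suc-injective size≡)

  tamari→plane : Tamari m → Plane (suc m)
  tamari→plane (t , nodes≡) = node (toForest t) ,
    cong suc (trans (sym (nodes-toBTree (toForest t))) (trans (cong nodes (toBTree-toForest t)) nodes≡))

  plane↔tamari : Plane (suc m) ↔ Tamari m
  plane↔tamari = mk↔ₛ′ plane→tamari tamari→plane to-from from-to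
    where
    to-from : ∀ t → plane→tamari (tamari→plane t) ≡ t
    to-from (t , _) = sized-≡ (toBTree-toForest t)

    from-to : ∀ T → tamari→plane (plane→tamari T) ≡ T
    from-to (node cs , _) = sized-≡ (cong node (toForest-toBTree cs))

module _ {n : ℕ} (par : Fin (suc n) → Fin (suc n)) (v : Fin (suc n)) where

  private
    isChild? : ∀ i → Dec (i ≢ Fin.zero × par i ≡ v)
    isChild? i = ¬? (i Finₚ.≟ Fin.zero) ×-dec (par i Finₚ.≟ v)

  ∈-childrenOf⁻ : ∀ {x} → x ∈ childrenOf par v → x ≢ Fin.zero × par x ≡ v
  ∈-childrenOf⁻ x∈ = proj₂ (∈-filter⁻ isChild? {xs = allFin (suc n)} x∈)

  ∈-childrenOf⁺ : ∀ {x} → x ≢ Fin.zero → par x ≡ v → x ∈ childrenOf par v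
  ∈-childrenOf⁺ {x} x≢0 px≡v = ∈-filter⁺ isChild? (∈-allFin x) (x≢0 , px≡v)

  childrenOf-increasing : Increasing (childrenOf par v)
  childrenOf-increasing = AllPairsₚ.filter⁺ isChild? (allFin-increasing (suc n))

module _ {n : ℕ} (σ : Perm (suc n)) (σ0≡0 : Inverse.to σ Fin.zero ≡ Fin.zero)
         (P Q : Fin (suc n) → Fin (suc n)) (Q∘σ≗σ∘P : ∀ i → Q (Inverse.to σ i) ≡ Inverse.to σ (P i))
         (siblings-mono : ∀ x y → P x ≡ P y → x Fin.< y → Inverse.to σ x Fin.< Inverse.to σ y) where

  open Inverse σ using (to; from; strictlyInverseˡ; strictlyInverseʳ)

  private
    to-injective : ∀ {x y} → to x ≡ to y → x ≡ y
    to-injective {x} {y} eq = trans (sym (strictlyInverseʳ x)) (trans (cong from eq) (strictlyInverseʳ y))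

    to≢0 : ∀ {x} → x ≢ Fin.zero → to x ≢ Fin.zero
    to≢0 x≢0 σx≡0 = x≢0 (to-injective (trans σx≡0 (sym σ0≡0)))

    ⊆-map : ∀ v → childrenOf Q (to v) ⊆ map to (childrenOf P v)
    ⊆-map v {z} z∈ = subst (_∈ map to (childrenOf P v)) (strictlyInverseˡ z)
                       (∈-map⁺ to (∈-childrenOf⁺ P v x≢0 (to-injective Px≡v)))
      where
      x : Fin (suc n)
      x = from z
      z≢0 : z ≢ Fin.zero
      z≢0 = proj₁ (∈-childrenOf⁻ Q (to v) z∈)
      Qz≡σv : Q z ≡ to v
      Qz≡σv = proj₂ (∈-childrenOf⁻ Q (to v) z∈)
      x≢0 : x ≢ Fin.zero
      x≢0 x≡0 = z≢0 (trans (sym (strictlyInverseˡ z)) (trans (cong to x≡0) σ0≡0))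
      Px≡v : to (P x) ≡ to v
      Px≡v = trans (sym (Q∘σ≗σ∘P x)) (trans (cong Q (strictlyInverseˡ z)) Qz≡σv)

    map-⊆ : ∀ v → map to (childrenOf P v) ⊆ childrenOf Q (to v)
    map-⊆ v z∈ with ∈-map⁻ to z∈
    ... | x , x∈ , refl = ∈-childrenOf⁺ Q (to v) (to≢0 (proj₁ (∈-childrenOf⁻ P v x∈)))
                            (trans (Q∘σ≗σ∘P x) (cong to (proj₂ (∈-childrenOf⁻ P v x∈))))

  childrenOf-relabel : ∀ v → childrenOf Q (to v) ≡ map to (childrenOf P v)
  childrenOf-relabel v = increasing-⊆-antisym (childrenOf-increasing Q (to v))
    (map-increasing to siblings-mono′ (childrenOf-increasing P v)) (⊆-map v) (map-⊆ v)
    where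
    siblings-mono′ : ∀ {x y} → x ∈ childrenOf P v → y ∈ childrenOf P v → x Fin.< y → to x Fin.< to y
    siblings-mono′ x∈ y∈ = siblings-mono _ _ (trans (proj₂ (∈-childrenOf⁻ P v x∈)) (sym (proj₂ (∈-childrenOf⁻ P v y∈))))

  ρsub-relabel : ∀ k v → ρsub Q k (to v) ≡ ρsub P k v
  ρsub-relabel zero v = refl
  ρsub-relabel (suc k) v = cong node (begin
    map (ρsub Q k) (childrenOf Q (to v))        ≡⟨ cong (map (ρsub Q k)) (childrenOf-relabel v) ⟩
    map (ρsub Q k) (map to (childrenOf P v))    ≡⟨ sym (map-∘ (childrenOf P v)) ⟩
    map (ρsub Q k ∘ to) (childrenOf P v)        ≡⟨ map-cong (ρsub-relabel k) (childrenOf P v) ⟩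
    map (ρsub P k) (childrenOf P v)             ∎)
    where open ≡-Reasoning

module NonCrossingForest {m : ℕ} (par : Fin (suc m) → Fin (suc m)) (e : ℕ → ℕ)
  (e-root : e 0 ≡ suc m) (e-range : InRange m e) (e-nonCrossing : NonCrossing m e)
  (par-e : ∀ x → (par x ≡ Fin.zero × e (toℕ x) ≡ suc m) ⊎ toℕ (par x) ≡ e (toℕ x)) where

  private
    n : ℕ
    n = suc m

    positive⇒≢0 : ∀ {a} {x : Fin n} → a < toℕ x → x ≢ Fin.zero
    positive⇒≢0 () refl

    ≢0⇒positive : ∀ {x : Fin n} → x ≢ Fin.zero → 1 ≤ toℕ x
    ≢0⇒positive {Fin.zero} x≢0 = contradiction refl x≢0
    ≢0⇒positive {Fin.suc _} _ = s≤s z≤n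

    x<e[x] : ∀ {x : Fin n} → x ≢ Fin.zero → toℕ x < e (toℕ x)
    x<e[x] {x} x≢0 = proj₁ (e-range (toℕ x) (≢0⇒positive x≢0) (≤-pred (Finₚ.toℕ<n x)))

    ∈-children⁻ : ∀ {d x} → d ≢ Fin.zero → x ∈ childrenOf par d → x ≢ Fin.zero × e (toℕ x) ≡ toℕ d
    ∈-children⁻ {d} {x} d≢0 x∈ with ∈-childrenOf⁻ par d x∈
    ... | x≢0 , px≡d with par-e x
    ...   | inj₁ (px≡0 , _) = contradiction (trans (sym px≡d) px≡0) d≢0
    ...   | inj₂ px≡e = x≢0 , trans (sym px≡e) (cong toℕ px≡d)

    ∈-children⁺ : ∀ {d x} → x ≢ Fin.zero → e (toℕ x) ≡ toℕ d → x ∈ childrenOf par d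
    ∈-children⁺ {d} {x} x≢0 ex≡d with par-e x
    ... | inj₁ (_ , ex≡n) = contradiction (trans (sym ex≡d) ex≡n) (<⇒≢ (Finₚ.toℕ<n d))
    ... | inj₂ px≡e = ∈-childrenOf⁺ par d x≢0 (Finₚ.toℕ-injective (trans px≡e ex≡d))

    ∈-roots⁻ : ∀ {x} → x ∈ childrenOf par Fin.zero → x ≢ Fin.zero × e (toℕ x) ≡ n
    ∈-roots⁻ {x} x∈ with ∈-childrenOf⁻ par Fin.zero x∈
    ... | x≢0 , px≡0 with par-e x
    ...   | inj₁ (_ , ex≡n) = x≢0 , ex≡n
    ...   | inj₂ px≡e = contradiction (subst (toℕ x <_) (trans (sym px≡e) (cong toℕ px≡0)) (x<e[x] x≢0)) λ ()

    ∈-roots⁺ : ∀ {x} → x ≢ Fin.zero → e (toℕ x) ≡ n → x ∈ childrenOf par Fin.zero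
    ∈-roots⁺ {x} x≢0 ex≡n with par-e x
    ... | inj₁ (px≡0 , _) = ∈-childrenOf⁺ par Fin.zero x≢0 px≡0
    ... | inj₂ px≡e = contradiction (trans px≡e ex≡n) (<⇒≢ (Finₚ.toℕ<n (par x)))

  -- The positions strictly between a and c carry a forest whose roots,
  -- the positions with parent c, are listed in cs.
  record Block (k a c : ℕ) (cs : List (Fin n)) : Set where
    field
      a<c     : a < c
      c≤n     : c ≤ n
      c≤e[a]  : c ≤ e a
      closed  : ∀ j → a < j → j < c → e j ≤ c
      fuel    : c ≤ a + suc k
      sorted  : Increasing cs
      roots⁻  : ∀ {x} → x ∈ cs → a < toℕ x × e (toℕ x) ≡ c
      roots⁺  : ∀ x → a < toℕ x → e (toℕ x) ≡ c → x ∈ cs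

  ForestArcs : ℕ → ℕ → ℕ → List (Fin n) → Set
  ForestArcs k a c cs =
    a + suc (sizes (map (ρsub par k) cs)) ≡ c ×
    (∀ p → 1 ≤ p → a + p < c → a + arcs (toBTree (map (ρsub par k) cs)) p ≡ e (a + p))

  private
    a+1≡ : ∀ a → a + suc 0 ≡ suc a
    a+1≡ a = trans (+-suc a 0) (cong suc (+-identityʳ a))

  block-[] : ∀ {k a c} → Block k a c [] → ForestArcs k a c []
  block-[] {a = a} {c = suc c′} B with m≤n⇒m<n∨m≡n (≤-pred (Block.a<c B))
  ... | inj₂ refl = a+1≡ a , λ p 1≤p a+p<c → contradiction (≤-pred a+p<c) (<⇒≱ (m<m+n a 1≤p))
  ... | inj₁ a<c′ = contradiction (roots⁺ x (subst (a <_) (sym x≡c′) a<c′) (subst (λ j → e j ≡ suc c′) (sym x≡c′) e[c′]≡c))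
                                  λ ()
    where
    open Block B
    c′<n : c′ < n
    c′<n = <-≤-trans (n<1+n c′) c≤n
    x : Fin n
    x = fromℕ< c′<n
    x≡c′ : toℕ x ≡ c′
    x≡c′ = Finₚ.toℕ-fromℕ< c′<n
    e[c′]≡c : e c′ ≡ suc c′
    e[c′]≡c = ≤-antisym (closed c′ a<c′ (n<1+n c′))
                        (proj₁ (e-range c′ (≤-trans (s≤s z≤n) a<c′) (≤-pred c′<n)))

  private
    no-fuel : ∀ {a c d cs} → ¬ Block 0 a c (d ∷ cs)
    no-fuel {a} {c} {d} B = <⇒≱ (<-≤-trans (s≤s a<d) d<c) (subst (c ≤_) (a+1≡ a) fuel)
      where
      open Block B
      a<d : a < toℕ d
      a<d = proj₁ (roots⁻ (here refl))
      d<c : toℕ d < c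
      d<c = subst (toℕ d <_) (proj₂ (roots⁻ (here refl))) (x<e[x] (positive⇒≢0 a<d))

  module _ {k a c : ℕ} {d : Fin n} {cs : List (Fin n)} (B : Block (suc k) a c (d ∷ cs)) where
    open Block B

    private
      a<d : a < toℕ d
      a<d = proj₁ (roots⁻ (here refl))

      e[d]≡c : e (toℕ d) ≡ c
      e[d]≡c = proj₂ (roots⁻ (here refl))

      d<c : toℕ d < c
      d<c = subst (toℕ d <_) e[d]≡c (x<e[x] (positive⇒≢0 a<d))

      closed-below-d : ∀ j → a < j → j < toℕ d → e j ≤ toℕ d
      closed-below-d j a<j j<d = ≮⇒≥ λ d<e[j] →
        y∉d∷cs (roots⁺ y (subst (a <_) (sym y≡j) a<j) (subst (λ i → e i ≡ c) (sym y≡j) (e[j]≡c d<e[j])))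
        where
        j<n : j < n
        j<n = <-trans j<d (Finₚ.toℕ<n d)
        y : Fin n
        y = fromℕ< j<n
        y≡j : toℕ y ≡ j
        y≡j = Finₚ.toℕ-fromℕ< j<n

        e[j]≡c : toℕ d < e j → e j ≡ c
        e[j]≡c d<e[j] = ≤-antisym (closed j a<j (<-trans j<d d<c))
          (subst (_≤ e j) e[d]≡c (e-nonCrossing j (toℕ d) (≤-trans (s≤s z≤n) a<j) j<d
                                                 (≤-pred (Finₚ.toℕ<n d)) d<e[j]))

        y∉d∷cs : ¬ y ∈ d ∷ cs
        y∉d∷cs (here y≡d) = contradiction (trans (sym y≡j) (cong toℕ y≡d)) (<⇒≢ j<d)
        y∉d∷cs (there y∈cs) = contradiction (subst (toℕ d <_) y≡j (All.lookup (AllPairs.head sorted) y∈cs)) (<-asym j<d)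

      child-right-of-a : ∀ {x} → x ∈ childrenOf par d → a < toℕ x × e (toℕ x) ≡ toℕ d
      child-right-of-a {x} x∈ with ∈-children⁻ (positive⇒≢0 a<d) x∈
      ... | x≢0 , e[x]≡d with <-cmp a (toℕ x)
      ...   | tri< a<x _ _ = a<x , e[x]≡d
      ...   | tri≈ _ refl _ = contradiction (≤-trans c≤e[a] (≤-reflexive e[x]≡d)) (<⇒≱ d<c)
      ...   | tri> _ _ x<a = contradiction (≤-trans c≤e[a] (subst (e a ≤_) e[x]≡d
                               (e-nonCrossing (toℕ x) a (≢0⇒positive x≢0) x<a (≤-pred (<-≤-trans a<c c≤n))
                                              (subst (a <_) (sym e[x]≡d) a<d))))
                               (<⇒≱ d<c)

    children-block : Block k a (toℕ d) (childrenOf par d)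
    children-block = record
      { a<c = a<d
      ; c≤n = <⇒≤ (Finₚ.toℕ<n d)
      ; c≤e[a] = ≤-trans (<⇒≤ d<c) c≤e[a]
      ; closed = closed-below-d
      ; fuel = ≤-pred (<-≤-trans d<c (subst (c ≤_) (+-suc a (suc k)) fuel))
      ; sorted = childrenOf-increasing par d
      ; roots⁻ = child-right-of-a
      ; roots⁺ = λ x a<x e[x]≡d → ∈-children⁺ (positive⇒≢0 a<x) e[x]≡d
      }

    siblings-block : Block (suc k) (toℕ d) c cs
    siblings-block = record
      { a<c = d<c
      ; c≤n = c≤n
      ; c≤e[a] = ≤-reflexive (sym e[d]≡c)
      ; closed = λ j d<j j<c → closed j (<-trans a<d d<j) j<c
      ; fuel = ≤-trans fuel (+-monoˡ-≤ (suc (suc k)) (<⇒≤ a<d))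
      ; sorted = AllPairs.tail sorted
      ; roots⁻ = λ x∈ → All.lookup (AllPairs.head sorted) x∈ , proj₂ (roots⁻ (there x∈))
      ; roots⁺ = sibling⁺
      }
      where
      sibling⁺ : ∀ x → toℕ d < toℕ x → e (toℕ x) ≡ c → x ∈ cs
      sibling⁺ x d<x e[x]≡c with roots⁺ x (<-trans a<d d<x) e[x]≡c
      ... | here refl = contradiction d<x (<-irrefl refl)
      ... | there x∈cs = x∈cs

  forestArcs-∷ : ∀ {k a c d cs} → e (toℕ d) ≡ c →
                 ForestArcs k a (toℕ d) (childrenOf par d) → ForestArcs (suc k) (toℕ d) c cs →
                 ForestArcs (suc k) a c (d ∷ cs)
  forestArcs-∷ {k} {a} {c} {d} {cs} e[d]≡c (size-d , arcs-d) (size-cs , arcs-cs) = size≡ , arcs≡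
    where
    open ≡-Reasoning
    D : ℕ
    D = toℕ d
    G : BTree
    G = toBTree (map (ρsub par k) (childrenOf par d))
    R : BTree
    R = toBTree (map (ρsub par (suc k)) cs)

    a+G≡D : a + suc (nodes G) ≡ D
    a+G≡D = trans (cong (λ s → a + suc s) (nodes-toBTree (map (ρsub par k) (childrenOf par d)))) size-d

    D+R≡c : D + suc (nodes R) ≡ c
    D+R≡c = trans (cong (λ s → D + suc s) (nodes-toBTree (map (ρsub par (suc k)) cs))) size-cs

    shift : ∀ a g w → a + (suc g + w) ≡ a + suc g + w
    shift = solve-∀

    size≡ : a + suc (suc (sizes (map (ρsub par k) (childrenOf par d))) + sizes (map (ρsub par (suc k)) cs)) ≡ c
    size≡ = trans (regroup a _ _) (trans (cong (_+ _) size-d) size-cs)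
      where
      regroup : ∀ a g r → a + suc (suc g + r) ≡ a + suc g + suc r
      regroup = solve-∀

    arcs≡ : ∀ p → 1 ≤ p → a + p < c → a + arcs (bin R G) p ≡ e (a + p)
    arcs≡ p 1≤p a+p<c with split (nodes G) p
    ... | inRight p≤g = arcs-d p 1≤p (subst (a + p <_) a+G≡D (+-monoʳ-< a (s≤s p≤g)))
    ... | atRoot = begin
      a + suc (suc (nodes R + nodes G))  ≡⟨ cong (a +_) (cong suc (+-comm (suc (nodes R)) (nodes G))) ⟩
      a + (suc (nodes G) + suc (nodes R)) ≡⟨ shift a (nodes G) (suc (nodes R)) ⟩
      a + suc (nodes G) + suc (nodes R)   ≡⟨ cong (_+ suc (nodes R)) a+G≡D ⟩
      D + suc (nodes R)                   ≡⟨ D+R≡c ⟩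
      c                                   ≡⟨ sym e[d]≡c ⟩
      e D                                 ≡⟨ cong e (sym a+G≡D) ⟩
      e (a + suc (nodes G))               ∎
    ... | inLeft q = begin
      a + (suc (nodes G) + arcs R (suc q))  ≡⟨ shift a (nodes G) _ ⟩
      a + suc (nodes G) + arcs R (suc q)    ≡⟨ cong (_+ arcs R (suc q)) a+G≡D ⟩
      D + arcs R (suc q)                    ≡⟨ arcs-cs (suc q) (s≤s z≤n) (subst (_< c) position≡ a+p<c) ⟩
      e (D + suc q)                         ≡⟨ cong e (sym position≡) ⟩
      e (a + (suc (nodes G) + suc q))       ∎
      where
      position≡ : a + (suc (nodes G) + suc q) ≡ D + suc q
      position≡ = trans (shift a (nodes G) (suc q)) (cong (_+ suc q) a+G≡D)

  blockForestArcs : ∀ k a c cs → Block k a c cs → ForestArcs k a c cs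
  blockForestArcs k a c [] B = block-[] B
  blockForestArcs zero a c (d ∷ cs) B = contradiction B no-fuel
  blockForestArcs (suc k) a c (d ∷ cs) B =
    forestArcs-∷ (proj₂ (Block.roots⁻ B (here refl)))
      (blockForestArcs k a (toℕ d) (childrenOf par d) (children-block B))
      (blockForestArcs (suc k) (toℕ d) c cs (siblings-block B))

  rootBlock : Block m 0 n (childrenOf par Fin.zero)
  rootBlock = record
    { a<c = s≤s z≤n
    ; c≤n = ≤-refl
    ; c≤e[a] = ≤-reflexive (sym e-root)
    ; closed = λ j 0<j j<n → proj₂ (e-range j 0<j (≤-pred j<n))
    ; fuel = ≤-refl
    ; sorted = childrenOf-increasing par Fin.zero
    ; roots⁻ = λ x∈ → ≢0⇒positive (proj₁ (∈-roots⁻ x∈)) , proj₂ (∈-roots⁻ x∈)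
    ; roots⁺ = λ x 0<x e[x]≡n → ∈-roots⁺ (positive⇒≢0 0<x) e[x]≡n
    }

  forest : List PTree
  forest = map (ρsub par m) (childrenOf par Fin.zero)

  sizes-forest : sizes forest ≡ m
  sizes-forest = suc-injective (proj₁ (blockForestArcs m 0 n _ rootBlock))

  arcs-forest : arcs (toBTree forest) ≗[ m ] e
  arcs-forest p 1≤p p≤m = proj₂ (blockForestArcs m 0 n _ rootBlock) p 1≤p (s≤s p≤m)

module FirstInversions {m : ℕ} (α : Perm (suc m)) where

  private
    n : ℕ
    n = suc m
    open Inverse α using (to; from; strictlyInverseʳ)

    inversion? : ∀ p q → Dec (IsInversion α p q)
    inversion? p q = (p Finₚ.<? q) ×-dec (to q Finₚ.<? to p)

    to-injective : ∀ {x y} → to x ≡ to y → x ≡ y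
    to-injective {x} {y} eq = trans (sym (strictlyInverseʳ x)) (trans (cong from eq) (strictlyInverseʳ y))

  first : Fin n → ℕ
  first p with firstInversion α p
  ... | just q = toℕ q
  ... | nothing = n

  parent : Fin n → Fin n
  parent p with firstInversion α p
  ... | just q = q
  ... | nothing = Fin.zero

  first-inversion : ∀ p → first p < n → ∃ λ q → toℕ q ≡ first p × IsInversion α p q
  first-inversion p first<n with firstInversion α p in eq
  ... | just q = q , refl , proj₁ (head-filter-just (inversion? p) (allFin-increasing n) eq)
  ... | nothing = contradiction first<n (<-irrefl refl)

  first-minimal : ∀ p r → IsInversion α p r → first p ≤ toℕ r
  first-minimal p r inv with firstInversion α p in eq
  ... | just q = proj₂ (head-filter-just (inversion? p) (allFin-increasing n) eq) (∈-allFin r) inv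
  ... | nothing = contradiction inv (head-filter-nothing (inversion? p) eq (∈-allFin r))

  first≤n : ∀ p → first p ≤ n
  first≤n p with firstInversion α p
  ... | just q = <⇒≤ (Finₚ.toℕ<n q)
  ... | nothing = ≤-refl

  p<first : ∀ p → toℕ p < first p
  p<first p with firstInversion α p in eq
  ... | just q = proj₁ (proj₁ (head-filter-just (inversion? p) (allFin-increasing n) eq))
  ... | nothing = Finₚ.toℕ<n p

  ascent-before-first : ∀ p r → toℕ p < toℕ r → toℕ r < first p → to p Fin.< to r
  ascent-before-first p r p<r r<first with Finₚ.<-cmp (to p) (to r)
  ... | tri< αp<αr _ _ = αp<αr
  ... | tri≈ _ αp≡αr _ = contradiction (cong toℕ (to-injective αp≡αr)) (<⇒≢ p<r)
  ... | tri> _ _ αr<αp = contradiction (first-minimal p r (p<r , αr<αp)) (<⇒≱ r<first)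

  -- With (p , q) the first inversion from p, α q < α p < α r makes (r , q) an inversion.
  first-nonCrossing : ∀ p r → toℕ p < toℕ r → toℕ r < first p → first r ≤ first p
  first-nonCrossing p r p<r r<first with first p <? n
  ... | no first≮n = subst (first r ≤_) (sym (≤-antisym (first≤n p) (≮⇒≥ first≮n))) (first≤n r)
  ... | yes first<n with first-inversion p first<n
  ...   | q , q≡first , (_ , αq<αp) = subst (first r ≤_) q≡first
    (first-minimal r q (subst (toℕ r <_) (sym q≡first) r<first ,
                        Finₚ.<-trans αq<αp (ascent-before-first p r p<r r<first)))

  parent-first : ∀ x → (parent x ≡ Fin.zero × first x ≡ n) ⊎ toℕ (parent x) ≡ first x
  parent-first x with firstInversion α x
  ... | just q = inj₂ refl
  ... | nothing = inj₁ (refl , refl)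

  arcsOf : ℕ → ℕ
  arcsOf p with p <? n
  ... | yes p<n = first (fromℕ< p<n)
  ... | no _ = n

  arcsOf-toℕ : ∀ x → arcsOf (toℕ x) ≡ first x
  arcsOf-toℕ x with toℕ x <? n
  ... | yes x<n = cong first (Finₚ.fromℕ<-toℕ x x<n)
  ... | no x≮n = contradiction (Finₚ.toℕ<n x) x≮n

  arcsOf-fromℕ< : ∀ {p} (p<n : p < n) → arcsOf p ≡ first (fromℕ< p<n)
  arcsOf-fromℕ< p<n = trans (cong arcsOf (sym (Finₚ.toℕ-fromℕ< p<n))) (arcsOf-toℕ (fromℕ< p<n))

  arcsOf-inRange : InRange m arcsOf
  arcsOf-inRange p _ p≤m =
    subst₂ _<_ (Finₚ.toℕ-fromℕ< (s≤s p≤m)) (sym (arcsOf-fromℕ< (s≤s p≤m))) (p<first _) ,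
    subst (_≤ n) (sym (arcsOf-fromℕ< (s≤s p≤m))) (first≤n _)

  arcsOf-nonCrossing : NonCrossing m arcsOf
  arcsOf-nonCrossing p r _ p<r r≤m r<arc = subst₂ _≤_ (sym (arcsOf-fromℕ< r<n)) (sym (arcsOf-fromℕ< p<n))
    (first-nonCrossing (fromℕ< p<n) (fromℕ< r<n)
      (subst₂ _<_ (sym (Finₚ.toℕ-fromℕ< p<n)) (sym (Finₚ.toℕ-fromℕ< r<n)) p<r)
      (subst₂ _<_ (sym (Finₚ.toℕ-fromℕ< r<n)) (arcsOf-fromℕ< p<n) r<arc))
    where
    r<n : r < n
    r<n = s≤s r≤m
    p<n : p < n
    p<n = <-trans p<r r<n

module FirstInversionTree {m : ℕ} (α : Perm (suc m)) (α0≡0 : Inverse.to α Fin.zero ≡ Fin.zero) where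

  private
    n : ℕ
    n = suc m
    open Inverse α using (to; from; strictlyInverseʳ)
    open FirstInversions α

  inversion⇒positive : ∀ {i j} → IsInversion α i j → 1 ≤ toℕ i
  inversion⇒positive {Fin.zero} {j} (_ , αj<α0) = contradiction (subst (to j Fin.<_) α0≡0 αj<α0) λ ()
  inversion⇒positive {Fin.suc _} _ = s≤s z≤n

  first-0 : first Fin.zero ≡ n
  first-0 with first Fin.zero <? n
  ... | no first≮n = ≤-antisym (first≤n Fin.zero) (≮⇒≥ first≮n)
  ... | yes first<n = contradiction (inversion⇒positive (proj₂ (proj₂ (first-inversion Fin.zero first<n)))) λ ()

  open NonCrossingForest parent arcsOf (trans (arcsOf-toℕ Fin.zero) first-0) arcsOf-inRange arcsOf-nonCrossing
    (λ x → subst (λ a → (parent x ≡ Fin.zero × a ≡ n) ⊎ toℕ (parent x) ≡ a) (sym (arcsOf-toℕ x)) (parent-first x))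
    public using (forest; sizes-forest; arcs-forest)

  private
    γparent≡ : ∀ i → γparent α i ≡ to (parent (from i))
    γparent≡ i with firstInversion α (from i)
    ... | just q = refl
    ... | nothing = sym α0≡0

    siblings-mono : ∀ x y → parent x ≡ parent y → x Fin.< y → to x Fin.< to y
    siblings-mono x y px≡py x<y = ascent-before-first x y x<y y<first
      where
      y<first : toℕ y < first x
      y<first with parent-first x | parent-first y
      ... | inj₁ (_ , first≡n) | _ = subst (toℕ y <_) (sym first≡n) (Finₚ.toℕ<n y)
      ... | inj₂ px≡first | inj₁ (py≡0 , _) =
        contradiction (trans (sym px≡first) (cong toℕ (trans px≡py py≡0))) (>⇒≢ (≤-<-trans z≤n (p<first x)))
      ... | inj₂ px≡first | inj₂ py≡first =
        subst (toℕ y <_) (trans (sym py≡first) (trans (cong toℕ (sym px≡py)) px≡first)) (p<first y)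

  ργ≡node-forest : ργ (α , α0≡0) ≡ node forest
  ργ≡node-forest = begin
    ρsub (γparent α) (suc m) Fin.zero         ≡⟨ cong (ρsub (γparent α) (suc m)) (sym α0≡0) ⟩
    ρsub (γparent α) (suc m) (to Fin.zero)    ≡⟨ ρsub-relabel α α0≡0 parent (γparent α) γparent∘to siblings-mono (suc m) Fin.zero ⟩
    ρsub parent (suc m) Fin.zero              ∎
    where
    open ≡-Reasoning
    γparent∘to : ∀ x → γparent α (to x) ≡ to (parent x)
    γparent∘to x = trans (γparent≡ (to x)) (cong (to ∘ parent) (strictlyInverseʳ x))

open FirstInversions
open FirstInversionTree

first-antitone : ∀ {m} (a b : S1×S (suc m)) → a ≤weak b → ∀ p → first (proj₁ b) p ≤ first (proj₁ a) p
first-antitone {m} (α , _) (β , _) a≤b p with first α p <? suc m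
... | yes first<n with first-inversion α p first<n
...   | q , q≡first , inv = subst (first β p ≤_) q≡first (first-minimal β p q (a≤b p q inv))
first-antitone {m} (α , _) (β , _) a≤b p | no first≮n =
  subst (first β p ≤_) (sym (≤-antisym (first≤n α p) (≮⇒≥ first≮n))) (first≤n β p)

≤[]-fromFin : ∀ {m} {u v : ℕ → ℕ} → (∀ (x : Fin (suc m)) → 1 ≤ toℕ x → u (toℕ x) ≤ v (toℕ x)) → u ≤[ m ] v
≤[]-fromFin {m} {u} {v} u≤v p 1≤p p≤m = subst (λ k → u k ≤ v k) x≡p (u≤v x (subst (1 ≤_) (sym x≡p) 1≤p))
  where
  x : Fin (suc m)
  x = fromℕ< (s≤s p≤m)
  x≡p : toℕ x ≡ p
  x≡p = Finₚ.toℕ-fromℕ< (s≤s p≤m)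

≤weak⇒arcs-≥ : ∀ {m} (a b : S1×S (suc m)) → a ≤weak b → arcsOf (proj₁ b) ≤[ m ] arcsOf (proj₁ a)
≤weak⇒arcs-≥ a b a≤b = ≤[]-fromFin λ x _ →
  subst₂ _≤_ (sym (arcsOf-toℕ (proj₁ b) x)) (sym (arcsOf-toℕ (proj₁ a) x)) (first-antitone a b a≤b x)

-- The greatest permutation whose arcs dominate u.
module MaxPerm {m : ℕ} (u : ℕ → ℕ) (u-range : InRange m u) (u-nonCrossing : NonCrossing m u) where

  private
    n : ℕ
    n = suc m

    EndsBy : ℕ → ℕ → Set
    EndsBy p q = 1 ≤ p × u p ≤ q

    EndsBy? : ∀ p q → Dec (EndsBy p q)
    EndsBy? p q = (1 ≤? p) ×-dec (u p ≤? q)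

    ¬EndsBy-from-0 : ∀ q → ¬ EndsBy 0 q
    ¬EndsBy-from-0 q (() , _)

    EndsBy-trans : ∀ {p q r} → p < q → q < r → r < n → EndsBy p q → EndsBy q r → EndsBy p r
    EndsBy-trans _ q<r _ (1≤p , u[p]≤q) _ = 1≤p , ≤-trans u[p]≤q (<⇒≤ q<r)

    ¬EndsBy-trans : ∀ {p q r} → p < q → q < r → r < n → ¬ EndsBy p q → ¬ EndsBy q r → ¬ EndsBy p r
    ¬EndsBy-trans {p} {q} p<q q<r r<n ¬Epq ¬Eqr (1≤p , u[p]≤r) =
      ¬Eqr (≤-trans 1≤p (<⇒≤ p<q) , ≤-trans u[q]≤u[p] u[p]≤r)
      where
      u[q]≤u[p] : u q ≤ u p
      u[q]≤u[p] = u-nonCrossing p q 1≤p p<q (≤-pred (<-trans q<r r<n)) (≰⇒> (¬Epq ∘ (1≤p ,_)))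

    open FromInversionSet m EndsBy? ¬EndsBy-from-0 EndsBy-trans ¬EndsBy-trans

  maxPerm : S1×S n
  maxPerm = permutation

  dominated⇒≤maxPerm : ∀ a → u ≤[ m ] arcsOf (proj₁ a) → a ≤weak maxPerm
  dominated⇒≤maxPerm (α , α0≡0) u≤arcs i j inv =
    I⇒isInversion i j (proj₁ inv) (1≤i , ≤-trans u[i]≤first (first-minimal α i j inv))
    where
    1≤i : 1 ≤ toℕ i
    1≤i = inversion⇒positive α α0≡0 inv
    u[i]≤first : u (toℕ i) ≤ first α i
    u[i]≤first = subst (u (toℕ i) ≤_) (arcsOf-toℕ α i)
                       (u≤arcs (toℕ i) 1≤i (≤-pred (<-trans (proj₁ inv) (Finₚ.toℕ<n j))))

  ≤maxPerm⇒dominated : ∀ a → a ≤weak maxPerm → u ≤[ m ] arcsOf (proj₁ a)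
  ≤maxPerm⇒dominated (α , _) a≤max = ≤[]-fromFin λ x 1≤x →
    subst (u (toℕ x) ≤_) (sym (arcsOf-toℕ α x)) (first-dominated x 1≤x)
    where
    first-dominated : ∀ x → 1 ≤ toℕ x → u (toℕ x) ≤ first α x
    first-dominated x 1≤x with first α x <? n
    ... | yes first<n with first-inversion α x first<n
    ...   | q , q≡first , inv = subst (u (toℕ x) ≤_) q≡first (proj₂ (isInversion⇒I x q (a≤max x q inv)))
    first-dominated x 1≤x | no first≮n = subst (u (toℕ x) ≤_) (≤-antisym (≮⇒≥ first≮n) (first≤n α x))
      (proj₂ (u-range (toℕ x) 1≤x (≤-pred (Finₚ.toℕ<n x))))

  arcsOf-maxPerm : arcsOf (proj₁ maxPerm) ≗[ m ] u
  arcsOf-maxPerm p 1≤p p≤m = ≤-antisym arcs≤u (≤maxPerm⇒dominated maxPerm (λ _ _ inv → inv) p 1≤p p≤m)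
    where
    arcs≤u : arcsOf (proj₁ maxPerm) p ≤ u p
    arcs≤u with u p <? n
    ... | no u[p]≮n = ≤-trans (proj₂ (arcsOf-inRange (proj₁ maxPerm) p 1≤p p≤m)) (≮⇒≥ u[p]≮n)
    ... | yes u[p]<n = subst₂ _≤_ (sym (arcsOf-fromℕ< (proj₁ maxPerm) p<n)) (Finₚ.toℕ-fromℕ< u[p]<n)
      (first-minimal (proj₁ maxPerm) x y (I⇒isInversion x y x<y (subst (1 ≤_) (sym x≡p) 1≤p , u[x]≤y)))
      where
      p<n : p < n
      p<n = s≤s p≤m
      x : Fin n
      x = fromℕ< p<n
      y : Fin n
      y = fromℕ< u[p]<n
      x≡p : toℕ x ≡ p
      x≡p = Finₚ.toℕ-fromℕ< p<n
      y≡u[p] : toℕ y ≡ u p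
      y≡u[p] = Finₚ.toℕ-fromℕ< u[p]<n
      x<y : toℕ x < toℕ y
      x<y = subst₂ _<_ (sym x≡p) (sym y≡u[p]) (proj₁ (u-range p 1≤p p≤m))
      u[x]≤y : u (toℕ x) ≤ toℕ y
      u[x]≤y = subst₂ _≤_ (cong u (sym x≡p)) (sym y≡u[p]) ≤-refl

inversion-trans : ∀ {n} (α : Perm n) {x y z} → IsInversion α x y → IsInversion α y z → IsInversion α x z
inversion-trans α (x<y , αy<αx) (y<z , αz<αy) = <-trans x<y y<z , <-trans αz<αy αy<αx

-- The least permutation whose arcs are dominated by u.
module MinPerm {m : ℕ} (u : ℕ → ℕ) where

  Confined : ℕ → ℕ → Set
  Confined p q = 1 ≤ p × (∀ {j} → j < q → p ≤ j → u j ≤ q)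

  private
    n : ℕ
    n = suc m

    Confined? : ∀ p q → Dec (Confined p q)
    Confined? p q = (1 ≤? p) ×-dec allUpTo? (λ j → (p ≤? j) →-dec (u j ≤? q)) q

    ¬Confined-from-0 : ∀ q → ¬ Confined 0 q
    ¬Confined-from-0 q (() , _)

    Confined-trans : ∀ {p q r} → p < q → q < r → r < n → Confined p q → Confined q r → Confined p r
    Confined-trans {p} {q} {r} _ q<r _ (1≤p , ends-by-q) (_ , ends-by-r) = 1≤p , ends-by-r′
      where
      ends-by-r′ : ∀ {j} → j < r → p ≤ j → u j ≤ r
      ends-by-r′ {j} j<r p≤j with j <? q
      ... | yes j<q = ≤-trans (ends-by-q j<q p≤j) (<⇒≤ q<r)
      ... | no j≮q = ends-by-r j<r (≮⇒≥ j≮q)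

    ¬Confined-trans : ∀ {p q r} → p < q → q < r → r < n → ¬ Confined p q → ¬ Confined q r → ¬ Confined p r
    ¬Confined-trans p<q _ _ _ ¬Cqr (1≤p , ends-by-r) =
      ¬Cqr (≤-trans 1≤p (<⇒≤ p<q) , λ j<r q≤j → ends-by-r j<r (≤-trans (<⇒≤ p<q) q≤j))

  open FromInversionSet m Confined? ¬Confined-from-0 Confined-trans ¬Confined-trans public
    using (isInversion⇒I; I⇒isInversion) renaming (permutation to minPerm)

  dominated⇒minPerm≤ : ∀ a → arcsOf (proj₁ a) ≤[ m ] u → minPerm ≤weak a
  dominated⇒minPerm≤ (α , _) arcs≤u i j inv = chain (toℕ j) i j (m≤n+m (toℕ j) (toℕ i)) (proj₁ inv) (isInversion⇒I i j inv)
    where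
    first≤j : ∀ {i j} → toℕ i < toℕ j → Confined (toℕ i) (toℕ j) → first α i ≤ toℕ j
    first≤j {i} {j} i<j (1≤i , ends-by-j) =
      ≤-trans (subst (_≤ u (toℕ i)) (arcsOf-toℕ α i) (arcs≤u _ 1≤i (≤-pred (<-trans i<j (Finₚ.toℕ<n j)))))
              (ends-by-j i<j ≤-refl)

    -- Follow first inversions from i: each one lands in (i , j], until one lands on j.
    chain : ∀ k i j → toℕ j ≤ toℕ i + k → toℕ i < toℕ j → Confined (toℕ i) (toℕ j) → IsInversion α i j
    chain zero i j j≤i+0 i<j _ = contradiction (subst (toℕ j ≤_) (+-identityʳ _) j≤i+0) (<⇒≱ i<j)
    chain (suc k) i j j≤i+k i<j Cij with first-inversion α i (≤-<-trans (first≤j i<j Cij) (Finₚ.toℕ<n j))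
    ... | q , q≡first , inv-iq with m≤n⇒m<n∨m≡n (subst (_≤ toℕ j) (sym q≡first) (first≤j i<j Cij))
    ...   | inj₂ q≡j = subst (IsInversion α i) (Finₚ.toℕ-injective q≡j) inv-iq
    ...   | inj₁ q<j = inversion-trans α inv-iq (chain k q j j≤q+k q<j Cqj)
      where
      i<q : toℕ i < toℕ q
      i<q = proj₁ inv-iq
      j≤q+k : toℕ j ≤ toℕ q + k
      j≤q+k = ≤-trans j≤i+k (subst (_≤ toℕ q + k) (sym (+-suc (toℕ i) k)) (+-monoˡ-≤ k i<q))
      Cqj : Confined (toℕ q) (toℕ j)
      Cqj = ≤-trans (proj₁ Cij) (<⇒≤ i<q) , λ l<j q≤l → proj₂ Cij l<j (≤-trans (<⇒≤ i<q) q≤l)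

  minPerm≤⇒dominated : InRange m u → NonCrossing m u → ∀ a → minPerm ≤weak a → arcsOf (proj₁ a) ≤[ m ] u
  minPerm≤⇒dominated u-range u-nonCrossing (α , _) min≤a p 1≤p p≤m with u p <? n
  ... | no u[p]≮n = ≤-trans (proj₂ (arcsOf-inRange α p 1≤p p≤m)) (≮⇒≥ u[p]≮n)
  ... | yes u[p]<n = subst₂ _≤_ (sym (arcsOf-fromℕ< α p<n)) y≡u[p]
                            (first-minimal α x y (min≤a x y (I⇒isInversion x y x<y Cxy)))
    where
    p<n : p < n
    p<n = s≤s p≤m
    x : Fin n
    x = fromℕ< p<n
    y : Fin n
    y = fromℕ< u[p]<n
    x≡p : toℕ x ≡ p
    x≡p = Finₚ.toℕ-fromℕ< p<n
    y≡u[p] : toℕ y ≡ u p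
    y≡u[p] = Finₚ.toℕ-fromℕ< u[p]<n
    x<y : toℕ x < toℕ y
    x<y = subst₂ _<_ (sym x≡p) (sym y≡u[p]) (proj₁ (u-range p 1≤p p≤m))
    ends-by-u[p] : ∀ {j} → j < u p → p ≤ j → u j ≤ u p
    ends-by-u[p] {j} j<u[p] p≤j with m≤n⇒m<n∨m≡n p≤j
    ... | inj₂ refl = ≤-refl
    ... | inj₁ p<j = u-nonCrossing p j 1≤p p<j (≤-pred (<-trans j<u[p] u[p]<n)) j<u[p]
    Cxy : Confined (toℕ x) (toℕ y)
    Cxy = subst₂ Confined (sym x≡p) (sym y≡u[p]) (1≤p , ends-by-u[p])

  ≤arcsOf-minPerm : (∀ p → 1 ≤ p → p ≤ m → u p ≤ n) → u ≤[ m ] arcsOf (proj₁ minPerm)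
  ≤arcsOf-minPerm u≤n = ≤[]-fromFin λ x 1≤x → subst (u (toℕ x) ≤_) (sym (arcsOf-toℕ (proj₁ minPerm) x)) (u≤first x 1≤x)
    where
    u≤first : ∀ x → 1 ≤ toℕ x → u (toℕ x) ≤ first (proj₁ minPerm) x
    u≤first x 1≤x with first (proj₁ minPerm) x <? n
    ... | no first≮n = subst (u (toℕ x) ≤_) (≤-antisym (≮⇒≥ first≮n) (first≤n (proj₁ minPerm) x))
                             (u≤n (toℕ x) 1≤x (≤-pred (Finₚ.toℕ<n x)))
    ... | yes first<n with first-inversion (proj₁ minPerm) x first<n
    ...   | q , q≡first , inv = subst (u (toℕ x) ≤_) q≡first (proj₂ (isInversion⇒I x q inv) (proj₁ inv) ≤-refl)

minPerm-antitone : ∀ {m} {v w : ℕ → ℕ} → v ≤[ m ] w → MinPerm.minPerm w ≤weak MinPerm.minPerm v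
minPerm-antitone {m} {v} {w} v≤w i j inv = V.I⇒isInversion i j (proj₁ inv) (1≤i , ends-by-j)
  where
  module V = MinPerm {m} v
  module W = MinPerm {m} w
  1≤i : 1 ≤ toℕ i
  1≤i = proj₁ (W.isInversion⇒I i j inv)
  ends-by-j : ∀ {l} → l < toℕ j → toℕ i ≤ l → v l ≤ toℕ j
  ends-by-j l<j i≤l = ≤-trans (v≤w _ (≤-trans 1≤i i≤l) (≤-pred (<-trans l<j (Finₚ.toℕ<n j))))
                              (proj₂ (W.isInversion⇒I i j inv) l<j i≤l)

compatible-resp-⇔ : ∀ {A : Set} {_≤_ E E′ : A → A → Set} →
                    (∀ {x y} → E′ x y → E x y) → (∀ {x y} → E x y → E′ x y) →
                    CompatibleWithJoinsMeets _≤_ E → CompatibleWithJoinsMeets _≤_ E′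
compatible-resp-⇔ E′⇒E E⇒E′ (joins , meets) =
  (λ x y z j j′ xy x∨z y∨z → E⇒E′ (joins x y z j j′ (E′⇒E xy) x∨z y∨z)) ,
  (λ x y z j j′ xy x∧z y∧z → E⇒E′ (meets x y z j j′ (E′⇒E xy) x∧z y∧z))

module PlaneLattice (m : ℕ) where

  private
    n : ℕ
    n = suc m
    S : Set
    S = S1×S n

  tree : Plane n → BTree
  tree T = proj₁ (plane→tamari m T)

  nodes-tree : ∀ T → nodes (tree T) ≡ m
  nodes-tree T = proj₂ (plane→tamari m T)

  tree-node : ∀ T {cs} → proj₁ T ≡ node cs → tree T ≡ toBTree cs
  tree-node (node _ , _) refl = refl

  arcsᵖ : Plane n → ℕ → ℕ
  arcsᵖ T = arcs (tree T)

  arcsᵖ-inRange : ∀ T → InRange m (arcsᵖ T)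
  arcsᵖ-inRange T = subst (λ k → InRange k (arcsᵖ T)) (nodes-tree T) (arcs-inRange (tree T))

  arcsᵖ-nonCrossing : ∀ T → NonCrossing m (arcsᵖ T)
  arcsᵖ-nonCrossing T = subst (λ k → NonCrossing k (arcsᵖ T)) (nodes-tree T) (arcs-nonCrossing (tree T))

  arcsᵖ-injective : ∀ {T T′} → arcsᵖ T ≗[ m ] arcsᵖ T′ → T ≡ T′
  arcsᵖ-injective {T} {T′} T≗T′ = begin
    T                                     ≡⟨ sym (Inverse.strictlyInverseʳ (plane↔tamari m) T) ⟩
    tamari→plane m (plane→tamari m T)      ≡⟨ cong (tamari→plane m) (sized-≡ tree≡) ⟩
    tamari→plane m (plane→tamari m T′)     ≡⟨ Inverse.strictlyInverseʳ (plane↔tamari m) T′ ⟩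
    T′                                    ∎
    where
    open ≡-Reasoning
    nodes≡ : nodes (tree T) ≡ nodes (tree T′)
    nodes≡ = trans (nodes-tree T) (sym (nodes-tree T′))
    tree≡ : tree T ≡ tree T′
    tree≡ = arcs-injective (tree T) (tree T′) nodes≡ (λ p 1≤p p≤ → T≗T′ p 1≤p (subst (p ≤_) (nodes-tree T) p≤))

  _⊑_ : Plane n → Plane n → Set
  T ⊑ T′ = plane→tamari m T ≤Tam plane→tamari m T′

  ⊑⇒arcs-≥ : ∀ {T T′} → T ⊑ T′ → arcsᵖ T′ ≤[ m ] arcsᵖ T
  ⊑⇒arcs-≥ {T} rots p 1≤p p≤m = star-rot⇒arcs-≥ rots p 1≤p (subst (p ≤_) (sym (nodes-tree T)) p≤m)

  arcs-≥⇒⊑ : ∀ {T T′} → arcsᵖ T′ ≤[ m ] arcsᵖ T → T ⊑ T′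
  arcs-≥⇒⊑ {T} {T′} T′≤T = arcs-≥⇒star-rot (tree T) (tree T′) (trans (nodes-tree T) (sym (nodes-tree T′)))
    (λ p 1≤p p≤ → T′≤T p 1≤p (subst (p ≤_) (nodes-tree T′) p≤))

  ⊑-antisym : ∀ {T T′} → T ⊑ T′ → T′ ⊑ T → T ≡ T′
  ⊑-antisym {T} {T′} T⊑T′ T′⊑T = arcsᵖ-injective {T} {T′} λ p 1≤p p≤m →
    ≤-antisym (⊑⇒arcs-≥ {T′} {T} T′⊑T p 1≤p p≤m) (⊑⇒arcs-≥ {T} {T′} T⊑T′ p 1≤p p≤m)

  ⊑-reflexive : ∀ {T T′} → T ≡ T′ → T ⊑ T′
  ⊑-reflexive refl = ε

  ⊑-isPartialOrder : IsPartialOrder _≡_ _⊑_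
  ⊑-isPartialOrder = record
    { isPreorder = record { isEquivalence = isEquivalence ; reflexive = ⊑-reflexive ; trans = _◅◅_ }
    ; antisym = ⊑-antisym
    }

  size-ργ : ∀ (a : S) → size (ργ a) ≡ n
  size-ργ (α , α0≡0) = trans (cong size (ργ≡node-forest α α0≡0)) (cong suc (sizes-forest α α0≡0))

  ργᵖ : S → Plane n
  ργᵖ a = ργ a , size-ργ a

  arcsᵖ-ργ : ∀ a → arcsᵖ (ργᵖ a) ≗[ m ] arcsOf (proj₁ a)
  arcsᵖ-ργ a@(α , α0≡0) p 1≤p p≤m =
    trans (cong (λ t → arcs t p) (tree-node (ργᵖ a) (ργ≡node-forest α α0≡0))) (arcs-forest α α0≡0 p 1≤p p≤m)

  ργ-mono : ∀ (a b : S) → a ≤weak b → ργᵖ a ⊑ ργᵖ b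
  ργ-mono a b a≤b = arcs-≥⇒⊑ {ργᵖ a} {ργᵖ b} (≤[]-resp-≗ (≗[]-sym (arcsᵖ-ργ b)) (≗[]-sym (arcsᵖ-ργ a)) (≤weak⇒arcs-≥ a b a≤b))

  upper : Plane n → S
  upper T = MaxPerm.maxPerm (arcsᵖ T) (arcsᵖ-inRange T) (arcsᵖ-nonCrossing T)

  ργ⊑⇒≤upper : ∀ {a T} → ργᵖ a ⊑ T → a ≤weak upper T
  ργ⊑⇒≤upper {a} {T} ργa⊑T = MaxPerm.dominated⇒≤maxPerm (arcsᵖ T) (arcsᵖ-inRange T) (arcsᵖ-nonCrossing T) a
    (≤[]-resp-≗ (λ _ _ _ → refl) (arcsᵖ-ργ a) (⊑⇒arcs-≥ {ργᵖ a} {T} ργa⊑T))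

  ≤upper⇒ργ⊑ : ∀ {a T} → a ≤weak upper T → ργᵖ a ⊑ T
  ≤upper⇒ργ⊑ {a} {T} a≤upper = arcs-≥⇒⊑ {ργᵖ a} {T}
    (≤[]-resp-≗ (λ _ _ _ → refl) (≗[]-sym (arcsᵖ-ργ a))
                (MaxPerm.≤maxPerm⇒dominated (arcsᵖ T) (arcsᵖ-inRange T) (arcsᵖ-nonCrossing T) a a≤upper))

  lower : Plane n → S
  lower T = MinPerm.minPerm (arcsᵖ T)

  ⊑ργ⇒lower≤ : ∀ {a T} → T ⊑ ργᵖ a → lower T ≤weak a
  ⊑ργ⇒lower≤ {a} {T} T⊑ργa = MinPerm.dominated⇒minPerm≤ (arcsᵖ T) a
    (≤[]-resp-≗ (arcsᵖ-ργ a) (λ _ _ _ → refl) (⊑⇒arcs-≥ {T} {ργᵖ a} T⊑ργa))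

  lower≤⇒⊑ργ : ∀ {a T} → lower T ≤weak a → T ⊑ ργᵖ a
  lower≤⇒⊑ργ {a} {T} lower≤a = arcs-≥⇒⊑ {T} {ργᵖ a}
    (≤[]-resp-≗ (≗[]-sym (arcsᵖ-ργ a)) (λ _ _ _ → refl)
                (MinPerm.minPerm≤⇒dominated (arcsᵖ T) (arcsᵖ-inRange T) (arcsᵖ-nonCrossing T) a lower≤a))

  planeWithArcs : (u : ℕ → ℕ) → InRange m u → NonCrossing m u → Plane n
  planeWithArcs u u-range u-nonCrossing = ργᵖ (MaxPerm.maxPerm u u-range u-nonCrossing)

  arcsᵖ-planeWithArcs : ∀ u (u-range : InRange m u) (u-nonCrossing : NonCrossing m u) →
                        arcsᵖ (planeWithArcs u u-range u-nonCrossing) ≗[ m ] u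
  arcsᵖ-planeWithArcs u u-range u-nonCrossing p 1≤p p≤m =
    trans (arcsᵖ-ργ (MaxPerm.maxPerm u u-range u-nonCrossing) p 1≤p p≤m) (MaxPerm.arcsOf-maxPerm u u-range u-nonCrossing p 1≤p p≤m)

  ργ-surjective : ∀ T → ∃ λ a → ργᵖ a ≡ T
  ργ-surjective T = upper T , arcsᵖ-injective {ργᵖ (upper T)} {T}
    (arcsᵖ-planeWithArcs (arcsᵖ T) (arcsᵖ-inRange T) (arcsᵖ-nonCrossing T))

  ⊑-joins : HasAllJoins _⊑_
  ⊑-joins T T′ = T∨T′ , T⊑T∨T′ , T′⊑T∨T′ , least
    where
    u : ℕ → ℕ
    u p = arcsᵖ T p ⊓ arcsᵖ T′ p
    T∨T′ : Plane n
    u-range : InRange m u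
    u-range = ⊓-inRange (arcsᵖ-inRange T) (arcsᵖ-inRange T′)
    u-nonCrossing : NonCrossing m u
    u-nonCrossing = ⊓-nonCrossing (arcsᵖ-nonCrossing T) (arcsᵖ-nonCrossing T′)
    T∨T′ = planeWithArcs u u-range u-nonCrossing
    u≗arcs : u ≗[ m ] arcsᵖ T∨T′
    u≗arcs = ≗[]-sym (arcsᵖ-planeWithArcs u u-range u-nonCrossing)
    T⊑T∨T′ : T ⊑ T∨T′
    T⊑T∨T′ = arcs-≥⇒⊑ {T} {T∨T′} (≤[]-resp-≗ u≗arcs (λ _ _ _ → refl) (λ _ _ _ → m⊓n≤m _ _))
    T′⊑T∨T′ : T′ ⊑ T∨T′
    T′⊑T∨T′ = arcs-≥⇒⊑ {T′} {T∨T′} (≤[]-resp-≗ u≗arcs (λ _ _ _ → refl) (λ _ _ _ → m⊓n≤n _ _))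
    least : ∀ W → T ⊑ W → T′ ⊑ W → T∨T′ ⊑ W
    least W T⊑W T′⊑W = arcs-≥⇒⊑ {T∨T′} {W} (≤[]-resp-≗ (λ _ _ _ → refl) u≗arcs λ p 1≤p p≤m →
      ⊓-glb (⊑⇒arcs-≥ {T} {W} T⊑W p 1≤p p≤m) (⊑⇒arcs-≥ {T′} {W} T′⊑W p 1≤p p≤m))

  ⊑-meets : HasAllMeets _⊑_
  ⊑-meets T T′ = T∧T′ , T∧T′⊑T , T∧T′⊑T′ , greatest
    where
    u : ℕ → ℕ
    u p = arcsᵖ T p ⊔ arcsᵖ T′ p
    T∧T′ : Plane n
    T∧T′ = ργᵖ (MinPerm.minPerm u)
    u≤arcs : u ≤[ m ] arcsᵖ T∧T′
    u≤arcs = ≤[]-resp-≗ (λ _ _ _ → refl) (≗[]-sym (arcsᵖ-ργ (MinPerm.minPerm u)))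
      (MinPerm.≤arcsOf-minPerm u λ p 1≤p p≤m → ⊔-lub (proj₂ (arcsᵖ-inRange T p 1≤p p≤m)) (proj₂ (arcsᵖ-inRange T′ p 1≤p p≤m)))
    T∧T′⊑T : T∧T′ ⊑ T
    T∧T′⊑T = arcs-≥⇒⊑ {T∧T′} {T} λ p 1≤p p≤m → ≤-trans (m≤m⊔n _ _) (u≤arcs p 1≤p p≤m)
    T∧T′⊑T′ : T∧T′ ⊑ T′
    T∧T′⊑T′ = arcs-≥⇒⊑ {T∧T′} {T′} λ p 1≤p p≤m → ≤-trans (m≤n⊔m _ _) (u≤arcs p 1≤p p≤m)
    greatest : ∀ W → W ⊑ T → W ⊑ T′ → W ⊑ T∧T′
    greatest W W⊑T W⊑T′ = lower≤⇒⊑ργ {MinPerm.minPerm u} {W} (minPerm-antitone λ p 1≤p p≤m →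
      ⊔-lub (⊑⇒arcs-≥ {W} {T} W⊑T p 1≤p p≤m) (⊑⇒arcs-≥ {W} {T′} W⊑T′ p 1≤p p≤m))

  ργ-preservesJoins : ∀ a b j → IsJoin _≤weak_ a b j → IsJoin _⊑_ (ργᵖ a) (ργᵖ b) (ργᵖ j)
  ργ-preservesJoins = upperAdjoint⇒preservesJoins {_≤A_ = _≤weak_} {_≤B_ = _⊑_} ργᵖ (λ {a} {b} → ργ-mono a b) upper
    (λ {a} {T} → ργ⊑⇒≤upper {a} {T}) (λ {a} {T} → ≤upper⇒ργ⊑ {a} {T})

  ργ-preservesMeets : ∀ a b j → IsMeet _≤weak_ a b j → IsMeet _⊑_ (ργᵖ a) (ργᵖ b) (ργᵖ j)
  ργ-preservesMeets = lowerAdjoint⇒preservesMeets {_≤A_ = _≤weak_} {_≤B_ = _⊑_} ργᵖ (λ {a} {b} → ργ-mono a b) lower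
    (λ {a} {T} → ⊑ργ⇒lower≤ {a} {T}) (λ {a} {T} → lower≤⇒⊑ργ {a} {T})

  ργ-congruence : CompatibleWithJoinsMeets (_≤weak_ {n}) (λ a b → ργ a ≡ ργ b)
  ργ-congruence = compatible-resp-⇔ sized-≡ (cong proj₁)
    (kernel-compatible (λ {T} {T′} → ⊑-antisym {T} {T′}) ργᵖ ργ-preservesJoins ργ-preservesMeets)

mainTheorem5 : (m : ℕ) →
    -- n = suc m ≥ 1
    -- (1) the fibers of ρ∘γ form a lattice congruence of the weak order
    CompatibleWithJoinsMeets (_≤weak_ {suc m}) (λ α β → ργ α ≡ ργ β) ×
    -- (2) ρ∘γ lands in plane(n), and there is a lattice structure ⊑ on plane(n)
    Σ (∀ (α : S1×S (suc m)) → size (ργ α) ≡ suc m) λ sz →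
      ∃ λ (_⊑_ : Plane (suc m) → Plane (suc m) → Set) →
        IsPartialOrder _≡_ _⊑_ ×
        HasAllJoins _⊑_ × HasAllMeets _⊑_ ×
        -- ρ∘γ is a lattice quotient: surjective, order-preserving, preserves joins and meets
        (∀ (T : Plane (suc m)) → ∃ λ (α : S1×S (suc m)) → (ργ α , sz α) ≡ T) ×
        (∀ α β → α ≤weak β → (ργ α , sz α) ⊑ (ργ β , sz β)) ×
        (∀ α β j → IsJoin _≤weak_ α β j → IsJoin _⊑_ (ργ α , sz α) (ργ β , sz β) (ργ j , sz j)) ×
        (∀ α β j → IsMeet _≤weak_ α β j → IsMeet _⊑_ (ργ α , sz α) (ργ β , sz β) (ργ j , sz j)) ×
        -- (3) (plane(n), ⊑) is isomorphic to the Tamari lattice T_{n-1}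
        ∃ λ (φ : Plane (suc m) ↔ Tamari m) →
          ∀ x y → (x ⊑ y) ⇔ (Inverse.to φ x ≤Tam Inverse.to φ y)
mainTheorem5 m =
  ργ-congruence , size-ργ , _⊑_ , ⊑-isPartialOrder , ⊑-joins , ⊑-meets , ργ-surjective ,
  ργ-mono , ργ-preservesJoins , ργ-preservesMeets , plane↔tamari m , λ _ _ → mk⇔ id id
  where open PlaneLattice m
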